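{- Let $A$ be a finite alphabet of colors. The linear maps $\psi:QSym_A\to QSym_A$ and $\psi:NSym_A\to NSym_A$ defined by $\psi(F_J)=F_{J^c}$ and $\psi(R_J)=R_{J^c}$ are involutions, the pairing is invariant under them, i.e. $\langle G,F\rangle=\langle\psi(G),\psi(F)\rangle$ for all $G\in NSym_A$, $F\in QSym_A$, and $\psi:NSym_A\to NSym_A$ is an algebra isomorphism.
   Context: Words are finite sequences of colors; a sentence is a finite sequence $I=(w_1,\dots,w_k)$ of nonempty words; $w(I)=w_1\cdots w_k$, $\ell(I)=k$. A sentence $I$ splits after its $i$-th letter if the $i$-th and $(i+1)$-th letters of $w(I)$ lie in different words of $I$. The complement $I^c$ is the unique sentence with $w(I^c)=w(I)$ which splits after exactly those positions $i\in\{1,\dots,|w(I)|-1\}$ after which $I$ does not split. $J\preceq I$ means $w(J)=w(I)$ and $I$ arises from $J$ by concatenating adjacent words. Variables $x_{a,i}$ ($a\in A$, $i\ge1$) satisfy only $x_{a,i}x_{b,j}=x_{b,j}x_{a,i}$ for $i\ne j$; $x_{w,i}=x_{c_1,i}\cdots x_{c_r,i}$. $M_I=\sum_{j_1<\dots<j_k}x_{w_1,j_1}\cdots x_{w_k,j_k}$; $QSym_A=\mathrm{span}\{M_I\}$; $F_I=\sum_{J\preceq I}M_J$. $NSym_A$ is the free associative $\mathbb{Q}$-algebra on generators $H_w$ ($w$ nonempty words), $H_I=H_{w_1}\cdots H_{w_k}$; $\langle H_I,M_J\rangle=\delta_{I,J}$; $R_I=\sum_{J\succeq I}(-1)^{\ell(J)-\ell(I)}H_J$,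 so that $\langle R_I,F_J\rangle=\delta_{I,J}$. -}

module Defs where

open import Data.Nat using (ℕ; _∸_)
open import Data.Bool using (Bool; true; false; not)
open import Data.Fin using (Fin)
import Data.Fin.Properties as FinP
open import Data.List using (List; []; _∷_; _++_; length; concatMap; map; foldr)
open import Data.List.NonEmpty using (List⁺; _∷_; toList)
open import Data.Product using (_×_; _,_)
open import Data.Rational using (ℚ; 0ℚ; 1ℚ; -_; _+_; _*_)
open import Relation.Binary.PropositionalEquality using (_≡_; refl; cong₂)
open import Relation.Nullary using (Dec; yes; no)
open import Relation.Nullary.Decidable using (map′)

Word : ℕ → Set
Word k = List⁺ (Fin k)

Sentence : ℕ → Set
Sentence k = List (Word k)

private
  decList : {X : Set} → ((x y : X) → Dec (x ≡ y)) → (xs ys : List X) → Dec (xs ≡ ys)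
  decList d [] [] = yes refl
  decList d [] (y ∷ ys) = no (λ ())
  decList d (x ∷ xs) [] = no (λ ())
  decList d (x ∷ xs) (y ∷ ys) with d x y | decList d xs ys
  ... | yes refl | yes refl = yes refl
  ... | no p | _ = no (λ { refl → p refl })
  ... | yes _ | no q = no (λ { refl → q refl })

  decWord : {k : ℕ} (u v : Word k) → Dec (u ≡ v)
  decWord (a ∷ as) (b ∷ bs) with FinP._≟_ a b | decList FinP._≟_ as bs
  ... | yes refl | yes refl = yes refl
  ... | no p | _ = no (λ { refl → p refl })
  ... | yes _ | no q = no (λ { refl → q refl })

_≟S_ : {k : ℕ} (I J : Sentence k) → Dec (I ≡ J)
_≟S_ = decList decWord

-- Complement I^c : same underlying word, splits exactly where I does not.
-- Encode a sentence as its letters, each flagged "I splits after this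
-- letter" (the final letter is flagged true by convention).

toFlags : {k : ℕ} → Sentence k → List (Fin k × Bool)
toFlags [] = []
toFlags ((a ∷ as) ∷ ws) = go a as ++ toFlags ws
  where
  go : _ → List _ → List _
  go a [] = (a , true) ∷ []
  go a (b ∷ bs) = (a , false) ∷ go b bs

fromFlags : {k : ℕ} → List (Fin k × Bool) → Sentence k
fromFlags [] = []
fromFlags ((a , true) ∷ rest) = (a ∷ []) ∷ fromFlags rest
fromFlags ((a , false) ∷ rest) with fromFlags rest
... | [] = (a ∷ []) ∷ []
... | (b ∷ bs) ∷ ws = (a ∷ b ∷ bs) ∷ ws

flipFlags : {k : ℕ} → List (Fin k × Bool) → List (Fin k × Bool)
flipFlags [] = []
flipFlags ((a , _) ∷ []) = (a , true) ∷ []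
flipFlags ((a , b) ∷ y ∷ ys) = (a , not b) ∷ flipFlags (y ∷ ys)

complement : {k : ℕ} → Sentence k → Sentence k
complement I = fromFlags (flipFlags (toFlags I))

-- Refinements  J ⪯ I  (split words of I into consecutive nonempty pieces)
-- and coarsenings J ⪰ I (concatenate adjacent words of I).

splitsW : {k : ℕ} → Fin k → List (Fin k) → List (Sentence k)
splitsW a [] = ((a ∷ []) ∷ []) ∷ []
splitsW a (b ∷ bs) = concatMap step (splitsW b bs)
  where
  step : Sentence _ → List (Sentence _)
  step [] = []
  step ((c ∷ cs) ∷ ps) = ((a ∷ c ∷ cs) ∷ ps) ∷ ((a ∷ []) ∷ (c ∷ cs) ∷ ps) ∷ []

refinements : {k : ℕ} → Sentence k → List (Sentence k)
refinements [] = [] ∷ []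
refinements ((a ∷ as) ∷ ws) =
  concatMap (λ P → map (λ Q → P ++ Q) (refinements ws)) (splitsW a as)

_++⁺_ : {k : ℕ} → Word k → Word k → Word k
(a ∷ as) ++⁺ v = a ∷ (as ++ toList v)

coarsenings : {k : ℕ} → Sentence k → List (Sentence k)
coarsenings [] = [] ∷ []
coarsenings (w ∷ ws) = concatMap step (coarsenings ws)
  where
  step : Sentence _ → List (Sentence _)
  step [] = (w ∷ []) ∷ []
  step (v ∷ K) = (w ∷ v ∷ K) ∷ ((w ++⁺ v) ∷ K) ∷ []

-- Both QSym_A and NSym_A are free ℚ-vector spaces with basis indexed by
-- sentences (the monomial basis M_I, resp. the basis H_I).

Vec : ℕ → Set
Vec k = List (ℚ × Sentence k)

coeff : {k : ℕ} → Vec k → Sentence k → ℚ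
coeff [] K = 0ℚ
coeff ((c , I) ∷ v) K with I ≟S K
... | yes _ = c + coeff v K
... | no _ = coeff v K

infix 4 _≈_
_≈_ : {k : ℕ} → Vec k → Vec k → Set
u ≈ v = ∀ K → coeff u K ≡ coeff v K

basis : {k : ℕ} → Sentence k → Vec k
basis I = (1ℚ , I) ∷ []

scale : {k : ℕ} → ℚ → Vec k → Vec k
scale c v = map (λ { (a , I) → (c * a , I) }) v

ext : {k : ℕ} → (Sentence k → Vec k) → Vec k → Vec k
ext f v = concatMap (λ { (c , I) → scale c (f I) }) v

-- F_I = Σ_{J ⪯ I} M_J   (in the M-basis of QSym_A)
Fb : {k : ℕ} → Sentence k → Vec k
Fb I = map (λ J → (1ℚ , J)) (refinements I)

signPow : ℕ → ℚ
signPow ℕ.zero = 1ℚ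
signPow (ℕ.suc m) = - signPow m

-- R_I = Σ_{J ⪰ I} (-1)^{ℓ(J)-ℓ(I)} H_J  (in the H-basis of NSym_A);
-- note ℓ(J) ≤ ℓ(I), so the sign is (-1)^{ℓ(I)-ℓ(J)}.
Rb : {k : ℕ} → Sentence k → Vec k
Rb I = map (λ J → (signPow (length I ∸ length J) , J)) (coarsenings I)

-- pairing ⟨G , F⟩ with ⟨H_I , M_J⟩ = δ_{I,J}
⟪_,_⟫ : {k : ℕ} → Vec k → Vec k → ℚ
⟪ G , F ⟫ = foldr (λ { (c , I) acc → c * coeff F I + acc }) 0ℚ G

infixl 7 _·_
_·_ : {k : ℕ} → Vec k → Vec k → Vec k
u · v = concatMap (λ { (a , I) → map (λ { (b , J) → (a * b , I ++ J) }) v }) u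

oneN : {k : ℕ} → Vec k
oneN = basis []

-- The first letter a of a nonempty sentence either forms a word of its own (sep a K) or is glued
-- onto the first word of a nonempty K (glue a K), and complementation exchanges the two shapes.
-- Refinements and coarsenings, hence F_J and R_J, obey matching recursions in this first letter, so
-- maps ψᴹ on the M-basis and ψᴴ on the H-basis defined by the same recursion send F_J to F_{J^c} and
-- R_J to R_{J^c}; the same recursions expand M_I in the F-basis and H_I in the R-basis. Therefore any
-- map with the defining property agrees with ψᴹ (resp. ψᴴ), and it is an involution because
-- (J^c)^c = J. Invariance of the pairing reduces to ⟨ψ H_I , ψ M_J⟩ = δ_{I,J} and multiplicativity
-- to ψ H_{IJ} = ψ H_I ψ H_J, both again by induction on the first letter. Vectors are compared
-- through the functionals g ↦ Σ c g(I) they define, which determine them since supports are finite.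

module Submission where

open import Defs
open import Data.Nat using (ℕ)
open import Data.Product using (Σ; _×_)
open import Relation.Binary.PropositionalEquality using (_≡_)

open import Data.Nat as ℕ using (suc; _∸_)
import Data.Nat.Properties as ℕ
open import Data.Fin using (Fin)
import Data.Fin.Properties as Fin
open import Data.List using (List; []; _∷_; _++_; length; concatMap; map)
open import Data.List.NonEmpty using (_∷_; toList)
open import Data.List.Relation.Unary.All as All using (All; []; _∷_)
import Data.List.Relation.Unary.All.Properties as All
open import Data.Product using (_,_; proj₁; proj₂)
import Data.List.Properties as List
open import Data.Bool using (Bool; true; false)
open import Data.Rational using (ℚ; 0ℚ; 1ℚ; -_; _+_; _*_; _-_)
import Data.Rational.Properties as ℚ
open import Data.Rational.Solver using (module +-*-Solver)
open +-*-Solver using (solve; _:+_; _:-_; _:*_; :-_; _:=_; con)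
open import Data.Unit using (tt)
open import Function using (_∘_)
open import Relation.Binary.PropositionalEquality
  using (refl; sym; trans; cong; cong₂; _≗_; module ≡-Reasoning)
open import Relation.Nullary using (Dec; yes; no; ¬_; contradiction)

private variable
  k : ℕ

⟦_⟧ : Vec k → (Sentence k → ℚ) → ℚ
⟦ [] ⟧ g = 0ℚ
⟦ (c , I) ∷ v ⟧ g = c * g I + ⟦ v ⟧ g

infixr 9 _⋆_
_⋆_ : (Sentence k → Vec k) → (Sentence k → ℚ) → Sentence k → ℚ
(f ⋆ g) L = ⟦ f L ⟧ g

⟦⟧-cong : (v : Vec k) {g h : Sentence k → ℚ} → g ≗ h → ⟦ v ⟧ g ≡ ⟦ v ⟧ h
⟦⟧-cong [] e = refl
⟦⟧-cong ((c , I) ∷ v) e = cong₂ (λ x y → c * x + y) (e I) (⟦⟧-cong v e)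

⟦⟧-++ : (u v : Vec k) (g : Sentence k → ℚ) → ⟦ u ++ v ⟧ g ≡ ⟦ u ⟧ g + ⟦ v ⟧ g
⟦⟧-++ [] v g = sym (ℚ.+-identityˡ _)
⟦⟧-++ ((c , I) ∷ u) v g =
  trans (cong (c * g I +_) (⟦⟧-++ u v g)) (sym (ℚ.+-assoc (c * g I) (⟦ u ⟧ g) (⟦ v ⟧ g)))

⟦⟧-basis : (I : Sentence k) (g : Sentence k → ℚ) → ⟦ basis I ⟧ g ≡ g I
⟦⟧-basis I g = trans (ℚ.+-identityʳ _) (ℚ.*-identityˡ _)

⟦⟧-+ : (v : Vec k) (g h : Sentence k → ℚ) → ⟦ v ⟧ (λ L → g L + h L) ≡ ⟦ v ⟧ g + ⟦ v ⟧ h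
⟦⟧-+ [] g h = sym (ℚ.+-identityˡ _)
⟦⟧-+ ((c , I) ∷ v) g h = trans (cong (c * (g I + h I) +_) (⟦⟧-+ v g h))
  (solve 5 (λ c x y p q → c :* (x :+ y) :+ (p :+ q) := (c :* x :+ p) :+ (c :* y :+ q))
     refl c (g I) (h I) (⟦ v ⟧ g) (⟦ v ⟧ h))

⟦⟧-* : (v : Vec k) (a : ℚ) (g : Sentence k → ℚ) → ⟦ v ⟧ (λ L → a * g L) ≡ a * ⟦ v ⟧ g
⟦⟧-* [] a g = sym (ℚ.*-zeroʳ a)
⟦⟧-* ((c , I) ∷ v) a g = trans (cong (c * (a * g I) +_) (⟦⟧-* v a g))
  (solve 4 (λ c a x p → c :* (a :* x) :+ a :* p := a :* (c :* x :+ p)) refl c a (g I) (⟦ v ⟧ g))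

⟦⟧-neg : (v : Vec k) (g : Sentence k → ℚ) → ⟦ v ⟧ (λ L → - g L) ≡ - ⟦ v ⟧ g
⟦⟧-neg [] g = refl
⟦⟧-neg ((c , I) ∷ v) g = trans (cong (c * - g I +_) (⟦⟧-neg v g))
  (solve 3 (λ c x p → c :* (:- x) :+ :- p := :- (c :* x :+ p)) refl c (g I) (⟦ v ⟧ g))

⟦⟧-- : (v : Vec k) (g h : Sentence k → ℚ) → ⟦ v ⟧ (λ L → g L - h L) ≡ ⟦ v ⟧ g - ⟦ v ⟧ h
⟦⟧-- v g h = trans (⟦⟧-+ v g (λ L → - h L)) (cong (⟦ v ⟧ g +_) (⟦⟧-neg v h))

⟦⟧-0 : (v : Vec k) → ⟦ v ⟧ (λ _ → 0ℚ) ≡ 0ℚ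
⟦⟧-0 [] = refl
⟦⟧-0 ((c , I) ∷ v) = trans (cong₂ _+_ (ℚ.*-zeroʳ c) (⟦⟧-0 v)) (ℚ.+-identityʳ 0ℚ)

⟦⟧-≗0 : (v : Vec k) {h : Sentence k → ℚ} → h ≗ (λ _ → 0ℚ) → ⟦ v ⟧ h ≡ 0ℚ
⟦⟧-≗0 v e = trans (⟦⟧-cong v e) (⟦⟧-0 v)

⟦⟧-scale : (c : ℚ) (v : Vec k) (g : Sentence k → ℚ) → ⟦ scale c v ⟧ g ≡ c * ⟦ v ⟧ g
⟦⟧-scale c [] g = sym (ℚ.*-zeroʳ c)
⟦⟧-scale c ((d , I) ∷ v) g = trans (cong (c * d * g I +_) (⟦⟧-scale c v g))
  (solve 4 (λ c d x y → c :* d :* x :+ c :* y := c :* (d :* x :+ y)) refl c d (g I) (⟦ v ⟧ g))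

⟦⟧-ext : (f : Sentence k → Vec k) (v : Vec k) (g : Sentence k → ℚ) → ⟦ ext f v ⟧ g ≡ ⟦ v ⟧ (f ⋆ g)
⟦⟧-ext f [] g = refl
⟦⟧-ext f ((c , I) ∷ v) g = trans (⟦⟧-++ (scale c (f I)) (ext f v) g)
  (cong₂ _+_ (⟦⟧-scale c (f I) g) (⟦⟧-ext f v g))

⊖_ : Vec k → Vec k
⊖ v = scale (- 1ℚ) v

⟦⟧-⊖ : (v : Vec k) (g : Sentence k → ℚ) → ⟦ ⊖ v ⟧ g ≡ - ⟦ v ⟧ g
⟦⟧-⊖ v g = trans (⟦⟧-scale (- 1ℚ) v g)
  (trans (sym (ℚ.neg-distribˡ-* 1ℚ (⟦ v ⟧ g))) (cong -_ (ℚ.*-identityˡ (⟦ v ⟧ g))))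

⟦⟧-++⊖ : (u v : Vec k) (g : Sentence k → ℚ) → ⟦ u ++ ⊖ v ⟧ g ≡ ⟦ u ⟧ g - ⟦ v ⟧ g
⟦⟧-++⊖ u v g = trans (⟦⟧-++ u (⊖ v) g) (cong (⟦ u ⟧ g +_) (⟦⟧-⊖ v g))

⟦⟧-swap : (u w : Vec k) (h : Sentence k → Sentence k → ℚ) →
  ⟦ u ⟧ (λ X → ⟦ w ⟧ (h X)) ≡ ⟦ w ⟧ (λ Y → ⟦ u ⟧ (λ X → h X Y))
⟦⟧-swap [] w h = sym (⟦⟧-0 w)
⟦⟧-swap ((c , I) ∷ u) w h = begin
  c * ⟦ w ⟧ (h I) + ⟦ u ⟧ (λ X → ⟦ w ⟧ (h X))
    ≡⟨ cong₂ _+_ (sym (⟦⟧-* w c (h I))) (⟦⟧-swap u w h) ⟩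
  ⟦ w ⟧ (λ Y → c * h I Y) + ⟦ w ⟧ (λ Y → ⟦ u ⟧ (λ X → h X Y))
    ≡⟨ sym (⟦⟧-+ w _ _) ⟩
  ⟦ w ⟧ (λ Y → c * h I Y + ⟦ u ⟧ (λ X → h X Y)) ∎
  where open ≡-Reasoning

⟦⟧-· : (u v : Vec k) (g : Sentence k → ℚ) → ⟦ u · v ⟧ g ≡ ⟦ u ⟧ (λ X → ⟦ v ⟧ (λ Y → g (X ++ Y)))
⟦⟧-· [] v g = refl
⟦⟧-· ((a , I) ∷ u) v g = trans (⟦⟧-++ (map _ v) (u · v) g) (cong₂ _+_ (left-factor v) (⟦⟧-· u v g))
  where
  left-factor : ∀ w → ⟦ map (λ { (b , J) → (a * b , I ++ J) }) w ⟧ g ≡ a * ⟦ w ⟧ (λ Y → g (I ++ Y))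
  left-factor [] = sym (ℚ.*-zeroʳ a)
  left-factor ((b , J) ∷ w) = trans (cong (a * b * g (I ++ J) +_) (left-factor w))
    (solve 4 (λ a b x p → a :* b :* x :+ a :* p := a :* (b :* x :+ p))
       refl a b (g (I ++ J)) (⟦ w ⟧ (λ Y → g (I ++ Y))))

δ : Sentence k → Sentence k → ℚ
δ I K = coeff (basis I) K

δ-refl : (I : Sentence k) → δ I I ≡ 1ℚ
δ-refl I with I ≟S I
... | yes _ = ℚ.+-identityʳ 1ℚ
... | no I≢I = contradiction refl I≢I

δ-≢ : {I K : Sentence k} → ¬ I ≡ K → δ I K ≡ 0ℚ
δ-≢ {I = I} {K} I≢K with I ≟S K
... | yes I≡K = contradiction I≡K I≢K
... | no _ = refl

δ-injective : (f : Sentence k → Sentence k) → (∀ {Z X} → f Z ≡ f X → Z ≡ X) →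
  (Z X : Sentence k) → δ (f Z) (f X) ≡ δ Z X
δ-injective f f-inj Z X = by-cases (Z ≟S X)
  where
  by-cases : Dec (Z ≡ X) → δ (f Z) (f X) ≡ δ Z X
  by-cases (yes refl) = trans (δ-refl (f Z)) (sym (δ-refl Z))
  by-cases (no Z≢X) = trans (δ-≢ (Z≢X ∘ f-inj)) (sym (δ-≢ Z≢X))

coeff-⟦⟧ : (v : Vec k) (K : Sentence k) → coeff v K ≡ ⟦ v ⟧ (λ I → δ I K)
coeff-⟦⟧ [] K = refl
coeff-⟦⟧ ((c , I) ∷ v) K with I ≟S K
... | yes _ = cong₂ _+_ (sym (trans (cong (c *_) (ℚ.+-identityʳ 1ℚ)) (ℚ.*-identityʳ c))) (coeff-⟦⟧ v K)
... | no _ = trans (coeff-⟦⟧ v K)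
  (sym (trans (cong (_+ ⟦ v ⟧ (λ I → δ I K)) (ℚ.*-zeroʳ c)) (ℚ.+-identityˡ _)))

⟦⟧≡⇒≈ : (u v : Vec k) → (∀ g → ⟦ u ⟧ g ≡ ⟦ v ⟧ g) → u ≈ v
⟦⟧≡⇒≈ u v e K = trans (coeff-⟦⟧ u K) (trans (e _) (sym (coeff-⟦⟧ v K)))

erase : Sentence k → Vec k → Vec k
erase I [] = []
erase I ((c , L) ∷ w) with L ≟S I
... | yes _ = erase I w
... | no _ = (c , L) ∷ erase I w

⟦⟧-erase : (I : Sentence k) (w : Vec k) (g : Sentence k → ℚ) →
  ⟦ w ⟧ g ≡ coeff w I * g I + ⟦ erase I w ⟧ g
⟦⟧-erase I [] g = sym (trans (cong (_+ 0ℚ) (ℚ.*-zeroˡ (g I))) (ℚ.+-identityʳ 0ℚ))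
⟦⟧-erase I ((c , L) ∷ w) g with L ≟S I
... | yes refl = trans (cong (c * g L +_) (⟦⟧-erase L w g))
  (solve 4 (λ c x a r → c :* x :+ (a :* x :+ r) := (c :+ a) :* x :+ r)
     refl c (g L) (coeff w L) (⟦ erase L w ⟧ g))
... | no _ = trans (cong (c * g L +_) (⟦⟧-erase I w g))
  (solve 5 (λ c x a y r → c :* x :+ (a :* y :+ r) := a :* y :+ (c :* x :+ r))
     refl c (g L) (coeff w I) (g I) (⟦ erase I w ⟧ g))

coeff-erase-≡ : (I : Sentence k) (w : Vec k) → coeff (erase I w) I ≡ 0ℚ
coeff-erase-≡ I [] = refl
coeff-erase-≡ I ((c , L) ∷ w) with L ≟S I
... | yes _ = coeff-erase-≡ I w
... | no L≢I with L ≟S I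
...   | yes L≡I = contradiction L≡I L≢I
...   | no _ = coeff-erase-≡ I w

coeff-erase-≢ : {I K : Sentence k} (w : Vec k) → ¬ K ≡ I → coeff (erase I w) K ≡ coeff w K
coeff-erase-≢ [] K≢I = refl
coeff-erase-≢ {I = I} {K} ((c , L) ∷ w) K≢I with L ≟S I
... | yes refl with L ≟S K
...   | yes refl = contradiction refl K≢I
...   | no _ = coeff-erase-≢ w K≢I
coeff-erase-≢ {I = I} {K} ((c , L) ∷ w) K≢I | no _ with L ≟S K
...   | yes _ = cong (c +_) (coeff-erase-≢ w K≢I)
...   | no _ = coeff-erase-≢ w K≢I

length-erase : (I : Sentence k) (w : Vec k) → length (erase I w) ℕ.≤ length w
length-erase I [] = ℕ.z≤n
length-erase I ((c , L) ∷ w) with L ≟S I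
... | yes _ = ℕ.m≤n⇒m≤1+n (length-erase I w)
... | no _ = ℕ.s≤s (length-erase I w)

-- n bounds the length because erase I w′ is not a structural subterm of w
coeff-0⇒⟦⟧-0 : (n : ℕ) (w : Vec k) → length w ℕ.≤ n → (∀ K → coeff w K ≡ 0ℚ) →
  (g : Sentence k → ℚ) → ⟦ w ⟧ g ≡ 0ℚ
coeff-0⇒⟦⟧-0 n [] _ _ g = refl
coeff-0⇒⟦⟧-0 (suc n) w@((c , I) ∷ w′) (ℕ.s≤s ∣w′∣≤n) w≡0 g = begin
  ⟦ w ⟧ g                              ≡⟨ ⟦⟧-erase I w g ⟩
  coeff w I * g I + ⟦ erase I w ⟧ g    ≡⟨ cong₂ (λ x y → x * g I + ⟦ y ⟧ g) (w≡0 I) (erase-head I) ⟩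
  0ℚ * g I + ⟦ erase I w′ ⟧ g          ≡⟨ cong₂ _+_ (ℚ.*-zeroˡ (g I)) rest≡0 ⟩
  0ℚ ∎
  where
  open ≡-Reasoning
  erase-head : (I : Sentence _) → erase I ((c , I) ∷ w′) ≡ erase I w′
  erase-head I with I ≟S I
  ... | yes _ = refl
  ... | no I≢I = contradiction refl I≢I
  coeff-rest : ∀ K → coeff (erase I w′) K ≡ 0ℚ
  coeff-rest K with K ≟S I
  ... | yes refl = coeff-erase-≡ K w′
  ... | no K≢I = trans (coeff-erase-≢ w′ K≢I) (trans (sym (skip-head I≢K)) (w≡0 K))
    where
    I≢K = λ I≡K → K≢I (sym I≡K)
    skip-head : ¬ I ≡ K → coeff w K ≡ coeff w′ K
    skip-head I≢K with I ≟S K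
    ... | yes I≡K = contradiction I≡K I≢K
    ... | no _ = refl
  rest≡0 : ⟦ erase I w′ ⟧ g ≡ 0ℚ
  rest≡0 = coeff-0⇒⟦⟧-0 n (erase I w′) (ℕ.≤-trans (length-erase I w′) ∣w′∣≤n) coeff-rest g

≈⇒⟦⟧≡ : (u v : Vec k) → u ≈ v → ∀ g → ⟦ u ⟧ g ≡ ⟦ v ⟧ g
≈⇒⟦⟧≡ u v u≈v g = begin
  ⟦ u ⟧ g                      ≡⟨ solve 2 (λ x y → x := y :+ (x :- y)) refl (⟦ u ⟧ g) (⟦ v ⟧ g) ⟩
  ⟦ v ⟧ g + (⟦ u ⟧ g - ⟦ v ⟧ g) ≡⟨ cong (⟦ v ⟧ g +_) (trans (sym (⟦⟧-++⊖ u v g)) (difference≡0 g)) ⟩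
  ⟦ v ⟧ g + 0ℚ                 ≡⟨ ℚ.+-identityʳ _ ⟩
  ⟦ v ⟧ g ∎
  where
  open ≡-Reasoning
  d = u ++ ⊖ v
  difference≡0 : ∀ h → ⟦ d ⟧ h ≡ 0ℚ
  difference≡0 = coeff-0⇒⟦⟧-0 (length d) d ℕ.≤-refl λ K → begin
    coeff d K                                          ≡⟨ trans (coeff-⟦⟧ d K) (⟦⟧-++⊖ u v _) ⟩
    ⟦ u ⟧ (λ I → δ I K) - ⟦ v ⟧ (λ I → δ I K)          ≡⟨ cong₂ _-_ (sym (coeff-⟦⟧ u K)) (sym (coeff-⟦⟧ v K)) ⟩
    coeff u K - coeff v K                              ≡⟨ cong (_- coeff v K) (u≈v K) ⟩
    coeff v K - coeff v K                              ≡⟨ ℚ.+-inverseʳ (coeff v K) ⟩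
    0ℚ ∎

∑ : {A : Set} → List A → (A → ℚ) → ℚ
∑ [] g = 0ℚ
∑ (x ∷ xs) g = g x + ∑ xs g

∑-++ : {A : Set} (xs ys : List A) (g : A → ℚ) → ∑ (xs ++ ys) g ≡ ∑ xs g + ∑ ys g
∑-++ [] ys g = sym (ℚ.+-identityˡ _)
∑-++ (x ∷ xs) ys g = trans (cong (g x +_) (∑-++ xs ys g)) (sym (ℚ.+-assoc (g x) (∑ xs g) (∑ ys g)))

∑-concatMap : {A B : Set} (f : A → List B) (xs : List A) (g : B → ℚ) →
  ∑ (concatMap f xs) g ≡ ∑ xs (λ x → ∑ (f x) g)
∑-concatMap f [] g = refl
∑-concatMap f (x ∷ xs) g = trans (∑-++ (f x) (concatMap f xs) g) (cong (∑ (f x) g +_) (∑-concatMap f xs g))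

∑-map : {A B : Set} (f : A → B) (xs : List A) (g : B → ℚ) → ∑ (map f xs) g ≡ ∑ xs (g ∘ f)
∑-map f [] g = refl
∑-map f (x ∷ xs) g = cong (g (f x) +_) (∑-map f xs g)

∑-cong : {A : Set} (xs : List A) {g h : A → ℚ} → g ≗ h → ∑ xs g ≡ ∑ xs h
∑-cong [] e = refl
∑-cong (x ∷ xs) e = cong₂ _+_ (e x) (∑-cong xs e)

∑-congᴬ : {A : Set} {P : A → Set} {xs : List A} → All P xs → {g h : A → ℚ} →
  (∀ x → P x → g x ≡ h x) → ∑ xs g ≡ ∑ xs h
∑-congᴬ [] e = refl
∑-congᴬ (p ∷ ps) e = cong₂ _+_ (e _ p) (∑-congᴬ ps e)

∑-+ : {A : Set} (xs : List A) (g h : A → ℚ) → ∑ xs (λ x → g x + h x) ≡ ∑ xs g + ∑ xs h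
∑-+ [] g h = sym (ℚ.+-identityˡ _)
∑-+ (x ∷ xs) g h = trans (cong (g x + h x +_) (∑-+ xs g h))
  (solve 4 (λ a b p q → (a :+ b) :+ (p :+ q) := (a :+ p) :+ (b :+ q)) refl (g x) (h x) (∑ xs g) (∑ xs h))

∑-neg : {A : Set} (xs : List A) (g : A → ℚ) → ∑ xs (λ x → - g x) ≡ - ∑ xs g
∑-neg [] g = refl
∑-neg (x ∷ xs) g = trans (cong (- g x +_) (∑-neg xs g)) (sym (ℚ.neg-distrib-+ (g x) (∑ xs g)))

∑-- : {A : Set} (xs : List A) (g h : A → ℚ) → ∑ xs (λ x → g x - h x) ≡ ∑ xs g - ∑ xs h
∑-- xs g h = trans (∑-+ xs g (λ x → - h x)) (cong (∑ xs g +_) (∑-neg xs h))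

concatMap⁺ : {A B : Set} {P : A → Set} {Q : B → Set} (f : A → List B) {xs : List A} →
  (∀ {x} → P x → All Q (f x)) → All P xs → All Q (concatMap f xs)
concatMap⁺ f h ps = All.concat⁺ (All.gmap⁺ h ps)

sep : Fin k → Sentence k → Sentence k
sep a K = (a ∷ []) ∷ K

glue : Fin k → Sentence k → Sentence k
glue a [] = sep a []
glue a (w ∷ K) = (a ∷ toList w) ∷ K

data NonEmpty {k : ℕ} : Sentence k → Set where
  nonempty : ∀ {w K} → NonEmpty (w ∷ K)

[]≢nonempty : {K : Sentence k} → NonEmpty K → ¬ [] ≡ K
[]≢nonempty nonempty ()

glue-nonempty : (a : Fin k) (K : Sentence k) → NonEmpty (glue a K)
glue-nonempty a [] = nonempty
glue-nonempty a (w ∷ K) = nonempty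

module _ {k : ℕ} (P : Sentence k → Set) (P[] : P [])
  (P-sep : ∀ a K → P K → P (sep a K))
  (P-glue : ∀ a K → NonEmpty K → P K → P (glue a K)) where

  mutual
    sentence-ind : ∀ I → P I
    sentence-ind [] = P[]
    sentence-ind ((a ∷ as) ∷ K) = firstWord-ind a as K

    firstWord-ind : ∀ a as K → P ((a ∷ as) ∷ K)
    firstWord-ind a [] K = P-sep a K (sentence-ind K)
    firstWord-ind a (b ∷ bs) K = P-glue a ((b ∷ bs) ∷ K) nonempty (firstWord-ind b bs K)

infix 10 _ᶜ
_ᶜ : Sentence k → Sentence k
I ᶜ = complement I

fromFlags-false : (a : Fin k) (r : List (Fin k × Bool)) → fromFlags ((a , false) ∷ r) ≡ glue a (fromFlags r)
fromFlags-false a r with fromFlags r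
... | [] = refl
... | w ∷ K = refl

ᶜ-sep : (a : Fin k) (K : Sentence k) → sep a K ᶜ ≡ glue a (K ᶜ)
ᶜ-sep a [] = refl
ᶜ-sep a ((b ∷ []) ∷ K) = fromFlags-false a (flipFlags ((b , true) ∷ toFlags K))
ᶜ-sep a ((b ∷ d ∷ ds) ∷ K) = fromFlags-false a (flipFlags (toFlags ((b ∷ d ∷ ds) ∷ K)))

ᶜ-glue : (a : Fin k) {K : Sentence k} → NonEmpty K → glue a K ᶜ ≡ sep a (K ᶜ)
ᶜ-glue a {(b ∷ []) ∷ K} nonempty = refl
ᶜ-glue a {(b ∷ d ∷ ds) ∷ K} nonempty = refl

ᶜ-nonempty : {K : Sentence k} → NonEmpty K → NonEmpty (K ᶜ)
ᶜ-nonempty {K = (a ∷ []) ∷ K} nonempty rewrite ᶜ-sep a K = glue-nonempty a (K ᶜ)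
ᶜ-nonempty {K = (a ∷ b ∷ bs) ∷ K} nonempty rewrite ᶜ-glue a {(b ∷ bs) ∷ K} nonempty = nonempty

ᶜ-involutive : (I : Sentence k) → I ᶜ ᶜ ≡ I
ᶜ-involutive = sentence-ind (λ I → I ᶜ ᶜ ≡ I) refl involutive-sep involutive-glue
  where
  involutive-sep : ∀ a K → K ᶜ ᶜ ≡ K → sep a K ᶜ ᶜ ≡ sep a K
  involutive-sep a [] _ = refl
  involutive-sep a K@(_ ∷ _) IH = begin
    sep a K ᶜ ᶜ      ≡⟨ cong _ᶜ (ᶜ-sep a K) ⟩
    glue a (K ᶜ) ᶜ   ≡⟨ ᶜ-glue a (ᶜ-nonempty {K = K} nonempty) ⟩
    sep a (K ᶜ ᶜ)    ≡⟨ cong (sep a) IH ⟩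
    sep a K ∎
    where open ≡-Reasoning
  involutive-glue : ∀ a K → NonEmpty K → K ᶜ ᶜ ≡ K → glue a K ᶜ ᶜ ≡ glue a K
  involutive-glue a K ne IH = begin
    glue a K ᶜ ᶜ     ≡⟨ cong _ᶜ (ᶜ-glue a ne) ⟩
    sep a (K ᶜ) ᶜ    ≡⟨ ᶜ-sep a (K ᶜ) ⟩
    glue a (K ᶜ ᶜ)   ≡⟨ cong (glue a) IH ⟩
    glue a K ∎
    where open ≡-Reasoning

-- The basis vectors of sep a K and glue a K, but zero for K = [], which has no first word to glue a onto.
sep⁺ glue⁺ : Fin k → Sentence k → Vec k
sep⁺ a [] = []
sep⁺ a K@(_ ∷ _) = basis (sep a K)
glue⁺ a [] = []
glue⁺ a K@(_ ∷ _) = basis (glue a K)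

⟦⟧-map : {A : Set} (f : A → ℚ × Sentence k) (xs : List A) (g : Sentence k → ℚ) →
  ⟦ map f xs ⟧ g ≡ ∑ xs (λ x → proj₁ (f x) * g (proj₂ (f x)))
⟦⟧-map f [] g = refl
⟦⟧-map f (x ∷ xs) g = cong (proj₁ (f x) * g (proj₂ (f x)) +_) (⟦⟧-map f xs g)

⟦Fb⟧ : (K : Sentence k) (g : Sentence k → ℚ) → ⟦ Fb K ⟧ g ≡ ∑ (refinements K) g
⟦Fb⟧ K g = trans (⟦⟧-map (1ℚ ,_) (refinements K) g)
  (∑-cong (refinements K) (λ J → ℚ.*-identityˡ (g J)))

Fb-sep : (a : Fin k) (K : Sentence k) (g : Sentence k → ℚ) → ⟦ Fb (sep a K) ⟧ g ≡ ⟦ Fb K ⟧ (g ∘ sep a)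
Fb-sep a K g = begin
  ⟦ Fb (sep a K) ⟧ g                      ≡⟨ ⟦Fb⟧ (sep a K) g ⟩
  ∑ (map (sep a) (refinements K) ++ []) g  ≡⟨ cong (λ xs → ∑ xs g) (List.++-identityʳ (map (sep a) (refinements K))) ⟩
  ∑ (map (sep a) (refinements K)) g        ≡⟨ ∑-map (sep a) (refinements K) g ⟩
  ∑ (refinements K) (g ∘ sep a)            ≡⟨ sym (⟦Fb⟧ K (g ∘ sep a)) ⟩
  ⟦ Fb K ⟧ (g ∘ sep a) ∎
  where open ≡-Reasoning

splitsW-nonempty : (a : Fin k) (as : List (Fin k)) → All NonEmpty (splitsW a as)
splitsW-nonempty a [] = nonempty ∷ []
splitsW-nonempty a (b ∷ bs) =
  concatMap⁺ _ (λ { {_ ∷ _} nonempty → nonempty ∷ nonempty ∷ [] }) (splitsW-nonempty b bs)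

Fb-glue : (a : Fin k) (K : Sentence k) (g : Sentence k → ℚ) →
  ⟦ Fb (glue a K) ⟧ g ≡ ⟦ Fb K ⟧ (g ∘ sep a) + ⟦ Fb K ⟧ (glue⁺ a ⋆ g)
Fb-glue a [] g = solve 1 (λ x → con 1ℚ :* x :+ con 0ℚ := (con 1ℚ :* x :+ con 0ℚ) :+ (con 1ℚ :* con 0ℚ :+ con 0ℚ))
  refl (g (sep a []))
Fb-glue a K@((b ∷ bs) ∷ ws) g = begin
  ⟦ Fb (glue a K) ⟧ g
    ≡⟨ trans (⟦Fb⟧ (glue a K) g) (trans (∑-concatMap _ (splitsW a (b ∷ bs)) g) (∑-concatMap _ (splitsW b bs) _)) ⟩
  _ ≡⟨ ∑-congᴬ (splitsW-nonempty b bs) (λ { (w ∷ ps) nonempty → sep-or-glue w ps }) ⟩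
  ∑ (splitsW b bs) (λ P → ∑ (refinements-after P) (g ∘ sep a) + ∑ (refinements-after P) (glue⁺ a ⋆ g))
    ≡⟨ ∑-+ (splitsW b bs) _ _ ⟩
  ∑ (splitsW b bs) (λ P → ∑ (refinements-after P) (g ∘ sep a))
    + ∑ (splitsW b bs) (λ P → ∑ (refinements-after P) (glue⁺ a ⋆ g))
    ≡⟨ sym (cong₂ _+_ (∑-concatMap _ (splitsW b bs) _) (∑-concatMap _ (splitsW b bs) _)) ⟩
  ∑ (refinements K) (g ∘ sep a) + ∑ (refinements K) (glue⁺ a ⋆ g)
    ≡⟨ sym (cong₂ _+_ (⟦Fb⟧ K (g ∘ sep a)) (⟦Fb⟧ K (glue⁺ a ⋆ g))) ⟩
  ⟦ Fb K ⟧ (g ∘ sep a) + ⟦ Fb K ⟧ (glue⁺ a ⋆ g) ∎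
  where
  open ≡-Reasoning
  refinements-after : Sentence _ → List (Sentence _)
  refinements-after P = map (P ++_) (refinements ws)
  sep-or-glue : ∀ w ps →
    ∑ (refinements-after (glue a (w ∷ ps))) g + (∑ (refinements-after (sep a (w ∷ ps))) g + 0ℚ)
    ≡ ∑ (refinements-after (w ∷ ps)) (g ∘ sep a) + ∑ (refinements-after (w ∷ ps)) (glue⁺ a ⋆ g)
  sep-or-glue w ps = begin
    ∑ (refinements-after (glue a P)) g + (∑ (refinements-after (sep a P)) g + 0ℚ)
      ≡⟨ cong₂ (λ x y → x + (y + 0ℚ)) (∑-map _ (refinements ws) g) (∑-map _ (refinements ws) g) ⟩
    ∑ (refinements ws) (λ Q → g (glue a (P ++ Q))) + (∑ (refinements ws) (λ Q → g (sep a (P ++ Q))) + 0ℚ)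
      ≡⟨ solve 2 (λ x y → x :+ (y :+ con 0ℚ) := y :+ x) refl glued separated ⟩
    separated + glued
      ≡⟨ sym (cong₂ _+_ (∑-map _ (refinements ws) _)
                        (trans (∑-map _ (refinements ws) _) (∑-cong (refinements ws) (λ Q → ⟦⟧-basis _ g)))) ⟩
    ∑ (refinements-after P) (g ∘ sep a) + ∑ (refinements-after P) (glue⁺ a ⋆ g) ∎
    where
    P = w ∷ ps
    separated glued : ℚ
    separated = ∑ (refinements ws) (λ Q → g (sep a (P ++ Q)))
    glued = ∑ (refinements ws) (λ Q → g (glue a (P ++ Q)))

⟦Rb⟧ : (K : Sentence k) (g : Sentence k → ℚ) →
  ⟦ Rb K ⟧ g ≡ ∑ (coarsenings K) (λ J → signPow (length K ∸ length J) * g J)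
⟦Rb⟧ K g = ⟦⟧-map _ (coarsenings K) g

coarsenings-shorter : (K : Sentence k) → All (λ J → length J ℕ.≤ length K) (coarsenings K)
coarsenings-shorter [] = ℕ.z≤n ∷ []
coarsenings-shorter (w ∷ ws) = concatMap⁺ _
  (λ { {[]} _ → ℕ.s≤s ℕ.z≤n ∷ []
     ; {v ∷ L} ∣J∣≤∣ws∣ → ℕ.s≤s ∣J∣≤∣ws∣ ∷ ℕ.m≤n⇒m≤1+n ∣J∣≤∣ws∣ ∷ [] })
  (coarsenings-shorter ws)

coarsenings-nonempty : (w : Word k) (ws : Sentence k) → All NonEmpty (coarsenings (w ∷ ws))
coarsenings-nonempty w ws = concatMap⁺ _
  (λ { {[]} _ → nonempty ∷ [] ; {v ∷ L} _ → nonempty ∷ nonempty ∷ [] })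
  (All.universal (λ _ → tt) (coarsenings ws))

Rb-sep : (a : Fin k) (K : Sentence k) (g : Sentence k → ℚ) →
  ⟦ Rb (sep a K) ⟧ g ≡ ⟦ Rb K ⟧ (g ∘ sep a) - ⟦ Rb K ⟧ (glue⁺ a ⋆ g)
Rb-sep a K g = begin
  ⟦ Rb (sep a K) ⟧ g
    ≡⟨ trans (⟦Rb⟧ (sep a K) g) (∑-concatMap _ (coarsenings K) _) ⟩
  _ ≡⟨ ∑-congᴬ (coarsenings-shorter K)
         (λ { [] _ → sep-only ; (v ∷ L) ∣J∣≤∣K∣ → sep-or-glue v L ∣J∣≤∣K∣ }) ⟩
  ∑ (coarsenings K) (λ J → s J * g (sep a J) - s J * (glue⁺ a ⋆ g) J)
    ≡⟨ ∑-- (coarsenings K) _ _ ⟩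
  ∑ (coarsenings K) (λ J → s J * g (sep a J)) - ∑ (coarsenings K) (λ J → s J * (glue⁺ a ⋆ g) J)
    ≡⟨ sym (cong₂ _-_ (⟦Rb⟧ K (g ∘ sep a)) (⟦Rb⟧ K (glue⁺ a ⋆ g))) ⟩
  ⟦ Rb K ⟧ (g ∘ sep a) - ⟦ Rb K ⟧ (glue⁺ a ⋆ g) ∎
  where
  open ≡-Reasoning
  s : Sentence _ → ℚ
  s J = signPow (length K ∸ length J)
  sep-only : s [] * g (sep a []) + 0ℚ ≡ s [] * g (sep a []) - s [] * 0ℚ
  sep-only = cong (s [] * g (sep a []) +_) (sym (cong -_ (ℚ.*-zeroʳ (s []))))
  -- gluing a onto J shortens the coarsening by one word, which flips the sign
  sep-or-glue : ∀ v L → length (v ∷ L) ℕ.≤ length K →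
    s (v ∷ L) * g (sep a (v ∷ L)) + (signPow (length K ∸ length L) * g (glue a (v ∷ L)) + 0ℚ)
    ≡ s (v ∷ L) * g (sep a (v ∷ L)) - s (v ∷ L) * (glue⁺ a ⋆ g) (v ∷ L)
  sep-or-glue v L ∣J∣≤∣K∣ rewrite ℕ.+-∸-assoc 1 ∣J∣≤∣K∣ =
    cong (s (v ∷ L) * g (sep a (v ∷ L)) +_)
      (trans (ℚ.+-identityʳ _)
        (trans (sym (ℚ.neg-distribˡ-* (s (v ∷ L)) _)) (cong (λ x → - (s (v ∷ L) * x)) (sym (⟦⟧-basis _ g)))))

Rb-glue : (a : Fin k) {K : Sentence k} → NonEmpty K → (g : Sentence k → ℚ) →
  ⟦ Rb (glue a K) ⟧ g ≡ ⟦ Rb K ⟧ (glue⁺ a ⋆ g)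
Rb-glue a {w ∷ ws} nonempty g =
  trans (⟦Rb⟧ (glue a (w ∷ ws)) g)
  (trans (∑-concatMap _ (coarsenings ws) _)
  (trans (∑-cong (coarsenings ws) (λ { [] → glued-word ; (v ∷ L) → glued-words v L }))
  (trans (sym (∑-concatMap _ (coarsenings ws) _))
  (sym (⟦Rb⟧ (w ∷ ws) (glue⁺ a ⋆ g))))))
  where
  glued-word : signPow (length ws) * g (glue a (w ∷ [])) + 0ℚ
             ≡ signPow (length ws) * (glue⁺ a ⋆ g) (w ∷ []) + 0ℚ
  glued-word = cong (λ x → signPow (length ws) * x + 0ℚ) (sym (⟦⟧-basis _ g))
  glued-words : ∀ v L →
    signPow (length ws ∸ suc (length L)) * g (glue a (w ∷ v ∷ L))
      + (signPow (length ws ∸ length L) * g (glue a ((w ++⁺ v) ∷ L)) + 0ℚ)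
    ≡ signPow (length ws ∸ suc (length L)) * (glue⁺ a ⋆ g) (w ∷ v ∷ L)
      + (signPow (length ws ∸ length L) * (glue⁺ a ⋆ g) ((w ++⁺ v) ∷ L) + 0ℚ)
  glued-words v L = cong₂ (λ x y → signPow (length ws ∸ suc (length L)) * x + (signPow (length ws ∸ length L) * y + 0ℚ))
    (sym (⟦⟧-basis _ g)) (sym (⟦⟧-basis _ g))

Sep Sep⁺ Glue : Fin k → Vec k → Vec k
Sep a = ext (basis ∘ sep a)
Sep⁺ a = ext (sep⁺ a)
Glue a = ext (glue⁺ a)

⟦Sep⟧ : (a : Fin k) (v : Vec k) (g : Sentence k → ℚ) → ⟦ Sep a v ⟧ g ≡ ⟦ v ⟧ (g ∘ sep a)
⟦Sep⟧ a v g = trans (⟦⟧-ext (basis ∘ sep a) v g) (⟦⟧-cong v (λ L → ⟦⟧-basis (sep a L) g))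

-- ψ(M_I) in the M-basis and ψ(H_I) in the H-basis
ψᴹ ψᴴ : Sentence k → Vec k
ψᴹ {k} = sentence-ind (λ _ → Vec k) (basis []) (λ a _ v → Sep a v ++ Glue a v) (λ a _ _ v → ⊖ Glue a v)
ψᴴ {k} = sentence-ind (λ _ → Vec k) (basis []) (λ a _ v → Sep a v) (λ a _ _ v → Sep⁺ a v ++ ⊖ Glue a v)

ψᴹ-sep : (a : Fin k) (L : Sentence k) (g : Sentence k → ℚ) →
  (ψᴹ ⋆ g) (sep a L) ≡ (ψᴹ ⋆ (g ∘ sep a)) L + (ψᴹ ⋆ (glue⁺ a ⋆ g)) L
ψᴹ-sep a L g = trans (⟦⟧-++ (Sep a (ψᴹ L)) (Glue a (ψᴹ L)) g)
  (cong₂ _+_ (⟦Sep⟧ a (ψᴹ L) g) (⟦⟧-ext (glue⁺ a) (ψᴹ L) g))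

glue⁺-ψᴹ : (a : Fin k) (L : Sentence k) (g : Sentence k → ℚ) →
  (glue⁺ a ⋆ ψᴹ ⋆ g) L ≡ - (ψᴹ ⋆ glue⁺ a ⋆ g) L
glue⁺-ψᴹ a [] g = refl
glue⁺-ψᴹ a L@(_ ∷ _) g = trans (⟦⟧-basis (glue a L) (ψᴹ ⋆ g))
  (trans (⟦⟧-⊖ (Glue a (ψᴹ L)) g) (cong -_ (⟦⟧-ext (glue⁺ a) (ψᴹ L) g)))

ψᴹ-Fb : (J : Sentence k) (g : Sentence k → ℚ) → ⟦ Fb J ⟧ (ψᴹ ⋆ g) ≡ ⟦ Fb (J ᶜ) ⟧ g
ψᴹ-Fb = sentence-ind (λ J → ∀ g → ⟦ Fb J ⟧ (ψᴹ ⋆ g) ≡ ⟦ Fb (J ᶜ) ⟧ g)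
  (λ g → cong (λ x → 1ℚ * x + 0ℚ) (⟦⟧-basis [] g)) case-sep case-glue
  where
  case-sep : ∀ a K → (∀ g → ⟦ Fb K ⟧ (ψᴹ ⋆ g) ≡ ⟦ Fb (K ᶜ) ⟧ g) →
    ∀ g → ⟦ Fb (sep a K) ⟧ (ψᴹ ⋆ g) ≡ ⟦ Fb (sep a K ᶜ) ⟧ g
  case-sep a K IH g = begin
    ⟦ Fb (sep a K) ⟧ (ψᴹ ⋆ g)
      ≡⟨ Fb-sep a K (ψᴹ ⋆ g) ⟩
    ⟦ Fb K ⟧ ((ψᴹ ⋆ g) ∘ sep a)
      ≡⟨ trans (⟦⟧-cong (Fb K) (λ L → ψᴹ-sep a L g)) (⟦⟧-+ (Fb K) _ _) ⟩
    ⟦ Fb K ⟧ (ψᴹ ⋆ (g ∘ sep a)) + ⟦ Fb K ⟧ (ψᴹ ⋆ glue⁺ a ⋆ g)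
      ≡⟨ cong₂ _+_ (IH (g ∘ sep a)) (IH (glue⁺ a ⋆ g)) ⟩
    ⟦ Fb (K ᶜ) ⟧ (g ∘ sep a) + ⟦ Fb (K ᶜ) ⟧ (glue⁺ a ⋆ g)
      ≡⟨ sym (Fb-glue a (K ᶜ) g) ⟩
    ⟦ Fb (glue a (K ᶜ)) ⟧ g
      ≡⟨ cong (λ I → ⟦ Fb I ⟧ g) (sym (ᶜ-sep a K)) ⟩
    ⟦ Fb (sep a K ᶜ) ⟧ g ∎
    where open ≡-Reasoning
  case-glue : ∀ a K → NonEmpty K → (∀ g → ⟦ Fb K ⟧ (ψᴹ ⋆ g) ≡ ⟦ Fb (K ᶜ) ⟧ g) →
    ∀ g → ⟦ Fb (glue a K) ⟧ (ψᴹ ⋆ g) ≡ ⟦ Fb (glue a K ᶜ) ⟧ g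
  case-glue a K K≢[] IH g = begin
    ⟦ Fb (glue a K) ⟧ (ψᴹ ⋆ g)
      ≡⟨ Fb-glue a K (ψᴹ ⋆ g) ⟩
    ⟦ Fb K ⟧ ((ψᴹ ⋆ g) ∘ sep a) + ⟦ Fb K ⟧ (glue⁺ a ⋆ ψᴹ ⋆ g)
      ≡⟨ cong₂ _+_ (trans (⟦⟧-cong (Fb K) (λ L → ψᴹ-sep a L g)) (⟦⟧-+ (Fb K) _ _))
                   (trans (⟦⟧-cong (Fb K) (λ L → glue⁺-ψᴹ a L g)) (⟦⟧-neg (Fb K) (ψᴹ ⋆ glue⁺ a ⋆ g))) ⟩
    (x + y) - y
      ≡⟨ solve 2 (λ x y → (x :+ y) :- y := x) refl x y ⟩
    ⟦ Fb K ⟧ (ψᴹ ⋆ (g ∘ sep a))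
      ≡⟨ IH (g ∘ sep a) ⟩
    ⟦ Fb (K ᶜ) ⟧ (g ∘ sep a)
      ≡⟨ sym (Fb-sep a (K ᶜ) g) ⟩
    ⟦ Fb (sep a (K ᶜ)) ⟧ g
      ≡⟨ cong (λ I → ⟦ Fb I ⟧ g) (sym (ᶜ-glue a K≢[])) ⟩
    ⟦ Fb (glue a K ᶜ) ⟧ g ∎
    where
    open ≡-Reasoning
    x y : ℚ
    x = ⟦ Fb K ⟧ (ψᴹ ⋆ (g ∘ sep a))
    y = ⟦ Fb K ⟧ (ψᴹ ⋆ glue⁺ a ⋆ g)

ψᴴ-sep : (a : Fin k) (L : Sentence k) (g : Sentence k → ℚ) → (ψᴴ ⋆ g) (sep a L) ≡ (ψᴴ ⋆ (g ∘ sep a)) L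
ψᴴ-sep a L g = ⟦Sep⟧ a (ψᴴ L) g

ψᴴ-glue : (a : Fin k) (L : Sentence k) → NonEmpty L → (g : Sentence k → ℚ) →
  (ψᴴ ⋆ g) (glue a L) ≡ (ψᴴ ⋆ sep⁺ a ⋆ g) L - (ψᴴ ⋆ glue⁺ a ⋆ g) L
ψᴴ-glue a L@(_ ∷ _) nonempty g = trans (⟦⟧-++⊖ (Sep⁺ a (ψᴴ L)) (Glue a (ψᴴ L)) g)
  (cong₂ _-_ (⟦⟧-ext (sep⁺ a) (ψᴴ L) g) (⟦⟧-ext (glue⁺ a) (ψᴴ L) g))

∂ : Fin k → (Sentence k → ℚ) → Sentence k → ℚ
∂ a g X = (sep⁺ a ⋆ g) X - (glue⁺ a ⋆ g) X

ψᴴ-glue′ : (a : Fin k) (L : Sentence k) → NonEmpty L → (g : Sentence k → ℚ) →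
  (ψᴴ ⋆ g) (glue a L) ≡ ⟦ ψᴴ L ⟧ (∂ a g)
ψᴴ-glue′ a L L≢[] g = trans (ψᴴ-glue a L L≢[] g) (sym (⟦⟧-- (ψᴴ L) (sep⁺ a ⋆ g) (glue⁺ a ⋆ g)))

glue⁺-ψᴴ : (a : Fin k) (L : Sentence k) (g : Sentence k → ℚ) →
  (glue⁺ a ⋆ ψᴴ ⋆ g) L ≡ (ψᴴ ⋆ sep⁺ a ⋆ g) L - (ψᴴ ⋆ glue⁺ a ⋆ g) L
glue⁺-ψᴴ a [] g = solve 0 (con 0ℚ := con 1ℚ :* con 0ℚ :+ con 0ℚ :- (con 1ℚ :* con 0ℚ :+ con 0ℚ)) refl
glue⁺-ψᴴ a L@(_ ∷ _) g = trans (⟦⟧-basis (glue a L) (ψᴴ ⋆ g)) (ψᴴ-glue a L nonempty g)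

Rb-sep⁺ : (a : Fin k) {M : Sentence k} → NonEmpty M → (g : Sentence k → ℚ) →
  ⟦ Rb M ⟧ (sep⁺ a ⋆ g) ≡ ⟦ Rb M ⟧ (g ∘ sep a)
Rb-sep⁺ a {w ∷ ws} nonempty g = trans (⟦Rb⟧ (w ∷ ws) (sep⁺ a ⋆ g))
  (trans (∑-congᴬ (coarsenings-nonempty w ws) (λ { J@(_ ∷ _) nonempty →
    cong (signPow (length (w ∷ ws) ∸ length J) *_) (⟦⟧-basis (sep a J) g) }))
  (sym (⟦Rb⟧ (w ∷ ws) (g ∘ sep a))))

Rb-glue-sep⁺ : (a : Fin k) (M : Sentence k) (g : Sentence k → ℚ) →
  ⟦ Rb M ⟧ (g ∘ sep a) - (⟦ Rb M ⟧ (sep⁺ a ⋆ g) - ⟦ Rb M ⟧ (glue⁺ a ⋆ g)) ≡ ⟦ Rb (glue a M) ⟧ g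
Rb-glue-sep⁺ a [] g =
  solve 1 (λ x → con 1ℚ :* x :+ con 0ℚ :- (con 1ℚ :* con 0ℚ :+ con 0ℚ :- (con 1ℚ :* con 0ℚ :+ con 0ℚ))
                 := con 1ℚ :* x :+ con 0ℚ) refl (g (sep a []))
Rb-glue-sep⁺ a M@(_ ∷ _) g = begin
  x - (⟦ Rb M ⟧ (sep⁺ a ⋆ g) - y) ≡⟨ cong (λ z → x - (z - y)) (Rb-sep⁺ a {M} nonempty g) ⟩
  x - (x - y)                     ≡⟨ solve 2 (λ x y → x :- (x :- y) := y) refl x y ⟩
  y                               ≡⟨ sym (Rb-glue a {M} nonempty g) ⟩
  ⟦ Rb (glue a M) ⟧ g ∎
  where
  open ≡-Reasoning
  x y : ℚ
  x = ⟦ Rb M ⟧ (g ∘ sep a)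
  y = ⟦ Rb M ⟧ (glue⁺ a ⋆ g)

ψᴴ-Rb : (J : Sentence k) (g : Sentence k → ℚ) → ⟦ Rb J ⟧ (ψᴴ ⋆ g) ≡ ⟦ Rb (J ᶜ) ⟧ g
ψᴴ-Rb = sentence-ind (λ J → ∀ g → ⟦ Rb J ⟧ (ψᴴ ⋆ g) ≡ ⟦ Rb (J ᶜ) ⟧ g)
  (λ g → cong (λ x → 1ℚ * x + 0ℚ) (⟦⟧-basis [] g)) case-sep case-glue
  where
  case-sep : ∀ a K → (∀ g → ⟦ Rb K ⟧ (ψᴴ ⋆ g) ≡ ⟦ Rb (K ᶜ) ⟧ g) →
    ∀ g → ⟦ Rb (sep a K) ⟧ (ψᴴ ⋆ g) ≡ ⟦ Rb (sep a K ᶜ) ⟧ g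
  case-sep a K IH g = begin
    ⟦ Rb (sep a K) ⟧ (ψᴴ ⋆ g)
      ≡⟨ Rb-sep a K (ψᴴ ⋆ g) ⟩
    ⟦ Rb K ⟧ ((ψᴴ ⋆ g) ∘ sep a) - ⟦ Rb K ⟧ (glue⁺ a ⋆ ψᴴ ⋆ g)
      ≡⟨ cong₂ _-_ (⟦⟧-cong (Rb K) (λ L → ψᴴ-sep a L g))
                   (trans (⟦⟧-cong (Rb K) (λ L → glue⁺-ψᴴ a L g))
                          (⟦⟧-- (Rb K) (ψᴴ ⋆ sep⁺ a ⋆ g) (ψᴴ ⋆ glue⁺ a ⋆ g))) ⟩
    ⟦ Rb K ⟧ (ψᴴ ⋆ (g ∘ sep a)) - (⟦ Rb K ⟧ (ψᴴ ⋆ sep⁺ a ⋆ g) - ⟦ Rb K ⟧ (ψᴴ ⋆ glue⁺ a ⋆ g))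
      ≡⟨ cong₂ _-_ (IH (g ∘ sep a)) (cong₂ _-_ (IH (sep⁺ a ⋆ g)) (IH (glue⁺ a ⋆ g))) ⟩
    ⟦ Rb (K ᶜ) ⟧ (g ∘ sep a) - (⟦ Rb (K ᶜ) ⟧ (sep⁺ a ⋆ g) - ⟦ Rb (K ᶜ) ⟧ (glue⁺ a ⋆ g))
      ≡⟨ Rb-glue-sep⁺ a (K ᶜ) g ⟩
    ⟦ Rb (glue a (K ᶜ)) ⟧ g
      ≡⟨ cong (λ I → ⟦ Rb I ⟧ g) (sym (ᶜ-sep a K)) ⟩
    ⟦ Rb (sep a K ᶜ) ⟧ g ∎
    where open ≡-Reasoning
  case-glue : ∀ a K → NonEmpty K → (∀ g → ⟦ Rb K ⟧ (ψᴴ ⋆ g) ≡ ⟦ Rb (K ᶜ) ⟧ g) →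
    ∀ g → ⟦ Rb (glue a K) ⟧ (ψᴴ ⋆ g) ≡ ⟦ Rb (glue a K ᶜ) ⟧ g
  case-glue a K K≢[] IH g = begin
    ⟦ Rb (glue a K) ⟧ (ψᴴ ⋆ g)
      ≡⟨ Rb-glue a K≢[] (ψᴴ ⋆ g) ⟩
    ⟦ Rb K ⟧ (glue⁺ a ⋆ ψᴴ ⋆ g)
      ≡⟨ trans (⟦⟧-cong (Rb K) (λ L → glue⁺-ψᴴ a L g))
               (⟦⟧-- (Rb K) (ψᴴ ⋆ sep⁺ a ⋆ g) (ψᴴ ⋆ glue⁺ a ⋆ g)) ⟩
    ⟦ Rb K ⟧ (ψᴴ ⋆ sep⁺ a ⋆ g) - ⟦ Rb K ⟧ (ψᴴ ⋆ glue⁺ a ⋆ g)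
      ≡⟨ cong₂ _-_ (IH (sep⁺ a ⋆ g)) (IH (glue⁺ a ⋆ g)) ⟩
    ⟦ Rb (K ᶜ) ⟧ (sep⁺ a ⋆ g) - ⟦ Rb (K ᶜ) ⟧ (glue⁺ a ⋆ g)
      ≡⟨ cong (_- ⟦ Rb (K ᶜ) ⟧ (glue⁺ a ⋆ g)) (Rb-sep⁺ a (ᶜ-nonempty K≢[]) g) ⟩
    ⟦ Rb (K ᶜ) ⟧ (g ∘ sep a) - ⟦ Rb (K ᶜ) ⟧ (glue⁺ a ⋆ g)
      ≡⟨ sym (Rb-sep a (K ᶜ) g) ⟩
    ⟦ Rb (sep a (K ᶜ)) ⟧ g
      ≡⟨ cong (λ I → ⟦ Rb I ⟧ g) (sym (ᶜ-glue a K≢[])) ⟩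
    ⟦ Rb (glue a K ᶜ) ⟧ g ∎
    where open ≡-Reasoning

-- M_I in the F-basis and H_I in the R-basis
Mᶠ Hᴿ : Sentence k → Vec k
Mᶠ {k} = sentence-ind (λ _ → Vec k) (basis []) (λ a _ v → Sep a v) (λ a _ _ v → Glue a v ++ ⊖ Sep⁺ a v)
Hᴿ {k} = sentence-ind (λ _ → Vec k) (basis []) (λ a _ v → Sep a v ++ Glue a v) (λ a _ _ v → Glue a v)

Fb-Mᶠ : (I : Sentence k) (g : Sentence k → ℚ) → ⟦ Mᶠ I ⟧ (Fb ⋆ g) ≡ g I
Fb-Mᶠ = sentence-ind (λ I → ∀ g → ⟦ Mᶠ I ⟧ (Fb ⋆ g) ≡ g I)
  (λ g → trans (⟦⟧-basis [] (Fb ⋆ g)) (⟦⟧-basis [] g)) case-sep case-glue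
  where
  case-sep : ∀ a K → (∀ g → ⟦ Mᶠ K ⟧ (Fb ⋆ g) ≡ g K) →
    ∀ g → ⟦ Mᶠ (sep a K) ⟧ (Fb ⋆ g) ≡ g (sep a K)
  case-sep a K IH g = begin
    ⟦ Sep a (Mᶠ K) ⟧ (Fb ⋆ g)     ≡⟨ ⟦Sep⟧ a (Mᶠ K) (Fb ⋆ g) ⟩
    ⟦ Mᶠ K ⟧ ((Fb ⋆ g) ∘ sep a)   ≡⟨ ⟦⟧-cong (Mᶠ K) (λ L → Fb-sep a L g) ⟩
    ⟦ Mᶠ K ⟧ (Fb ⋆ (g ∘ sep a))   ≡⟨ IH (g ∘ sep a) ⟩
    g (sep a K) ∎
    where open ≡-Reasoning
  glue⁺-minus-sep⁺ : ∀ a g L → (glue⁺ a ⋆ Fb ⋆ g) L - (sep⁺ a ⋆ Fb ⋆ g) L ≡ (Fb ⋆ glue⁺ a ⋆ g) L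
  glue⁺-minus-sep⁺ a g [] = refl
  glue⁺-minus-sep⁺ a g L@(_ ∷ _) = begin
    (glue⁺ a ⋆ Fb ⋆ g) L - (sep⁺ a ⋆ Fb ⋆ g) L
      ≡⟨ cong₂ _-_ (trans (⟦⟧-basis (glue a L) (Fb ⋆ g)) (Fb-glue a L g))
                   (trans (⟦⟧-basis (sep a L) (Fb ⋆ g)) (Fb-sep a L g)) ⟩
    (x + y) - x  ≡⟨ solve 2 (λ x y → (x :+ y) :- x := y) refl x y ⟩
    y ∎
    where
    open ≡-Reasoning
    x y : ℚ
    x = ⟦ Fb L ⟧ (g ∘ sep a)
    y = ⟦ Fb L ⟧ (glue⁺ a ⋆ g)
  case-glue : ∀ a K → NonEmpty K → (∀ g → ⟦ Mᶠ K ⟧ (Fb ⋆ g) ≡ g K) →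
    ∀ g → ⟦ Mᶠ (glue a K) ⟧ (Fb ⋆ g) ≡ g (glue a K)
  case-glue a K@(_ ∷ _) nonempty IH g = begin
    ⟦ Glue a (Mᶠ K) ++ ⊖ Sep⁺ a (Mᶠ K) ⟧ (Fb ⋆ g)
      ≡⟨ trans (⟦⟧-++⊖ (Glue a (Mᶠ K)) (Sep⁺ a (Mᶠ K)) (Fb ⋆ g))
               (cong₂ _-_ (⟦⟧-ext (glue⁺ a) (Mᶠ K) (Fb ⋆ g)) (⟦⟧-ext (sep⁺ a) (Mᶠ K) (Fb ⋆ g))) ⟩
    ⟦ Mᶠ K ⟧ (glue⁺ a ⋆ Fb ⋆ g) - ⟦ Mᶠ K ⟧ (sep⁺ a ⋆ Fb ⋆ g)
      ≡⟨ sym (⟦⟧-- (Mᶠ K) (glue⁺ a ⋆ Fb ⋆ g) (sep⁺ a ⋆ Fb ⋆ g)) ⟩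
    ⟦ Mᶠ K ⟧ (λ L → (glue⁺ a ⋆ Fb ⋆ g) L - (sep⁺ a ⋆ Fb ⋆ g) L)
      ≡⟨ ⟦⟧-cong (Mᶠ K) (glue⁺-minus-sep⁺ a g) ⟩
    ⟦ Mᶠ K ⟧ (Fb ⋆ glue⁺ a ⋆ g)
      ≡⟨ IH (glue⁺ a ⋆ g) ⟩
    (glue⁺ a ⋆ g) K
      ≡⟨ ⟦⟧-basis (glue a K) g ⟩
    g (glue a K) ∎
    where open ≡-Reasoning

glue⁺-Rb : (a : Fin k) (g : Sentence k → ℚ) → (glue⁺ a ⋆ Rb ⋆ g) ≗ (Rb ⋆ glue⁺ a ⋆ g)
glue⁺-Rb a g [] = refl
glue⁺-Rb a g L@(_ ∷ _) = trans (⟦⟧-basis (glue a L) (Rb ⋆ g)) (Rb-glue a {L} nonempty g)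

Rb-Hᴿ : (I : Sentence k) (g : Sentence k → ℚ) → ⟦ Hᴿ I ⟧ (Rb ⋆ g) ≡ g I
Rb-Hᴿ = sentence-ind (λ I → ∀ g → ⟦ Hᴿ I ⟧ (Rb ⋆ g) ≡ g I)
  (λ g → trans (⟦⟧-basis [] (Rb ⋆ g)) (⟦⟧-basis [] g)) case-sep case-glue
  where
  case-sep : ∀ a K → (∀ g → ⟦ Hᴿ K ⟧ (Rb ⋆ g) ≡ g K) →
    ∀ g → ⟦ Hᴿ (sep a K) ⟧ (Rb ⋆ g) ≡ g (sep a K)
  case-sep a K IH g = begin
    ⟦ Sep a (Hᴿ K) ++ Glue a (Hᴿ K) ⟧ (Rb ⋆ g)
      ≡⟨ trans (⟦⟧-++ (Sep a (Hᴿ K)) _ (Rb ⋆ g))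
               (cong₂ _+_ (⟦Sep⟧ a (Hᴿ K) (Rb ⋆ g))
                          (trans (⟦⟧-ext (glue⁺ a) (Hᴿ K) (Rb ⋆ g)) (⟦⟧-cong (Hᴿ K) (glue⁺-Rb a g)))) ⟩
    ⟦ Hᴿ K ⟧ ((Rb ⋆ g) ∘ sep a) + y
      ≡⟨ cong (_+ y) (trans (⟦⟧-cong (Hᴿ K) (λ L → Rb-sep a L g))
                            (⟦⟧-- (Hᴿ K) (Rb ⋆ (g ∘ sep a)) (Rb ⋆ glue⁺ a ⋆ g))) ⟩
    (x - y) + y
      ≡⟨ solve 2 (λ x y → (x :- y) :+ y := x) refl x y ⟩
    x
      ≡⟨ IH (g ∘ sep a) ⟩
    g (sep a K) ∎
    where
    open ≡-Reasoning
    x y : ℚ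
    x = ⟦ Hᴿ K ⟧ (Rb ⋆ (g ∘ sep a))
    y = ⟦ Hᴿ K ⟧ (Rb ⋆ glue⁺ a ⋆ g)
  case-glue : ∀ a K → NonEmpty K → (∀ g → ⟦ Hᴿ K ⟧ (Rb ⋆ g) ≡ g K) →
    ∀ g → ⟦ Hᴿ (glue a K) ⟧ (Rb ⋆ g) ≡ g (glue a K)
  case-glue a K@(_ ∷ _) nonempty IH g = begin
    ⟦ Glue a (Hᴿ K) ⟧ (Rb ⋆ g)        ≡⟨ ⟦⟧-ext (glue⁺ a) (Hᴿ K) (Rb ⋆ g) ⟩
    ⟦ Hᴿ K ⟧ (glue⁺ a ⋆ Rb ⋆ g)       ≡⟨ ⟦⟧-cong (Hᴿ K) (glue⁺-Rb a g) ⟩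
    ⟦ Hᴿ K ⟧ (Rb ⋆ glue⁺ a ⋆ g)       ≡⟨ IH (glue⁺ a ⋆ g) ⟩
    (glue⁺ a ⋆ g) K                   ≡⟨ ⟦⟧-basis (glue a K) g ⟩
    g (glue a K) ∎
    where open ≡-Reasoning

infix 9 _at_
_at_ : Vec k → Sentence k → ℚ
v at X = ⟦ v ⟧ (λ I → δ I X)

basis-at : (Z X : Sentence k) → basis Z at X ≡ δ Z X
basis-at Z X = ⟦⟧-basis Z (λ I → δ I X)

sep-injective : {a : Fin k} {Z X : Sentence k} → sep a Z ≡ sep a X → Z ≡ X
sep-injective refl = refl

glue-injective : {a : Fin k} {Z X : Sentence k} → glue a Z ≡ glue a X → Z ≡ X
glue-injective {Z = []} {[]} _ = refl
glue-injective {Z = w ∷ Z} {w′ ∷ X} refl = refl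

Sep-at-sep : (a : Fin k) (v : Vec k) (X : Sentence k) → Sep a v at sep a X ≡ v at X
Sep-at-sep a v X = trans (⟦⟧-ext (basis ∘ sep a) v _)
  (⟦⟧-cong v (λ Z → trans (basis-at (sep a Z) (sep a X)) (δ-injective (sep a) sep-injective Z X)))

Sep-at-other : (b : Fin k) (v : Vec k) {Y : Sentence k} → (∀ Z → ¬ sep b Z ≡ Y) → Sep b v at Y ≡ 0ℚ
Sep-at-other b v {Y} ≢Y = trans (⟦⟧-ext (basis ∘ sep b) v _)
  (⟦⟧-≗0 v (λ Z → trans (basis-at (sep b Z) Y) (δ-≢ (≢Y Z))))

Glue-at-glue : (a : Fin k) (v : Vec k) {X : Sentence k} → NonEmpty X → Glue a v at glue a X ≡ v at X
Glue-at-glue a v {X} X≢[] = trans (⟦⟧-ext (glue⁺ a) v _) (⟦⟧-cong v pointwise)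
  where
  pointwise : ∀ Z → glue⁺ a Z at glue a X ≡ δ Z X
  pointwise [] = sym (δ-≢ ([]≢nonempty X≢[]))
  pointwise Z@(_ ∷ _) = trans (basis-at (glue a Z) (glue a X)) (δ-injective (glue a) glue-injective Z X)

Glue-at-other : (b : Fin k) (v : Vec k) {Y : Sentence k} → (∀ Z → NonEmpty Z → ¬ glue b Z ≡ Y) →
  Glue b v at Y ≡ 0ℚ
Glue-at-other b v {Y} ≢Y = trans (⟦⟧-ext (glue⁺ b) v _) (⟦⟧-≗0 v pointwise)
  where
  pointwise : ∀ Z → glue⁺ b Z at Y ≡ 0ℚ
  pointwise [] = refl
  pointwise Z@(_ ∷ _) = trans (basis-at (glue b Z) Y) (δ-≢ (≢Y Z nonempty))

sep-letter : {a b : Fin k} {Z X : Sentence k} → sep a Z ≡ sep b X → a ≡ b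
sep-letter refl = refl

glue-letter : {a b : Fin k} {Z X : Sentence k} → glue a Z ≡ glue b X → a ≡ b
glue-letter {Z = []} {[]} refl = refl
glue-letter {Z = _ ∷ _} {_ ∷ _} refl = refl

sep≢glue : {a b : Fin k} {Z X : Sentence k} → NonEmpty X → ¬ sep a Z ≡ glue b X
sep≢glue nonempty ()

Sep-at-sep-≢ : {a b : Fin k} (v : Vec k) (X : Sentence k) → ¬ a ≡ b → Sep b v at sep a X ≡ 0ℚ
Sep-at-sep-≢ v X a≢b = Sep-at-other _ v (λ Z eq → a≢b (sym (sep-letter eq)))

Sep-at-glue : {a b : Fin k} (v : Vec k) {X : Sentence k} → NonEmpty X → Sep b v at glue a X ≡ 0ℚ
Sep-at-glue v X≢[] = Sep-at-other _ v (λ Z → sep≢glue X≢[])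

Glue-at-sep : {a b : Fin k} (v : Vec k) (X : Sentence k) → Glue b v at sep a X ≡ 0ℚ
Glue-at-sep v X = Glue-at-other _ v (λ Z Z≢[] → sep≢glue Z≢[] ∘ sym)

Glue-at-glue-≢ : {a b : Fin k} (v : Vec k) (X : Sentence k) → ¬ a ≡ b → Glue b v at glue a X ≡ 0ℚ
Glue-at-glue-≢ v X a≢b = Glue-at-other _ v (λ Z _ eq → a≢b (sym (glue-letter eq)))

ψᴹ-sep-at : (b : Fin k) (J Y : Sentence k) → ψᴹ (sep b J) at Y ≡ Sep b (ψᴹ J) at Y + Glue b (ψᴹ J) at Y
ψᴹ-sep-at b J Y = ⟦⟧-++ (Sep b (ψᴹ J)) (Glue b (ψᴹ J)) _

ψᴹ-glue-at : (b : Fin k) {J : Sentence k} → NonEmpty J → (Y : Sentence k) →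
  ψᴹ (glue b J) at Y ≡ - Glue b (ψᴹ J) at Y
ψᴹ-glue-at b {J@(_ ∷ _)} nonempty Y = ⟦⟧-⊖ (Glue b (ψᴹ J)) _

ψᴹ-at-[] : (J : Sentence k) → ψᴹ J at [] ≡ δ J []
ψᴹ-at-[] {k} [] = basis-at {k} [] []
ψᴹ-at-[] ((b ∷ []) ∷ J) = trans (ψᴹ-sep-at b J [])
  (trans (cong₂ _+_ (Sep-at-other b (ψᴹ J) {[]} (λ _ ())) (Glue-at-other b (ψᴹ J) {[]} (λ { (_ ∷ _) _ () })))
         (trans (ℚ.+-identityʳ 0ℚ) (sym (δ-≢ {I = sep b J} {[]} λ ()))))
ψᴹ-at-[] ((b ∷ c ∷ cs) ∷ J) = trans (ψᴹ-glue-at b {(c ∷ cs) ∷ J} nonempty [])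
  (trans (cong -_ (Glue-at-other b (ψᴹ ((c ∷ cs) ∷ J)) {[]} (λ { (_ ∷ _) _ () })))
         (sym (δ-≢ {I = glue b ((c ∷ cs) ∷ J)} {[]} λ ())))

[]≢glue : {a : Fin k} {X : Sentence k} → ¬ [] ≡ glue a X
[]≢glue {X = []} ()
[]≢glue {X = _ ∷ _} ()

Dual : Sentence k → Set
Dual I = ∀ J → ⟦ ψᴴ I ⟧ (ψᴹ J at_) ≡ δ J I

dual-sep : (a : Fin k) (K : Sentence k) → Dual K →
  (J : Sentence k) → ⟦ ψᴴ K ⟧ ((ψᴹ J at_) ∘ sep a) ≡ δ J (sep a K)
dual-sep a K IH [] = trans (⟦⟧-≗0 (ψᴴ K) (λ X → trans (basis-at [] (sep a X)) (δ-≢ {I = []} {sep a X} λ ())))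
  (sym (δ-≢ {I = []} {sep a K} λ ()))
dual-sep a K IH ((b ∷ []) ∷ J) with a Fin.≟ b
... | yes refl = trans (⟦⟧-cong (ψᴴ K) same-letter) (trans (IH J) (sym (δ-injective (sep a) sep-injective J K)))
  where
  same-letter : ∀ X → ψᴹ (sep a J) at sep a X ≡ ψᴹ J at X
  same-letter X = trans (ψᴹ-sep-at a J (sep a X))
    (trans (cong₂ _+_ (Sep-at-sep a (ψᴹ J) X) (Glue-at-sep (ψᴹ J) X)) (ℚ.+-identityʳ _))
... | no a≢b = trans (⟦⟧-≗0 (ψᴴ K) other-letter) (sym (δ-≢ {I = sep b J} {sep a K} (a≢b ∘ sym ∘ sep-letter)))
  where
  other-letter : ∀ X → ψᴹ (sep b J) at sep a X ≡ 0ℚ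
  other-letter X = trans (ψᴹ-sep-at b J (sep a X))
    (trans (cong₂ _+_ (Sep-at-sep-≢ (ψᴹ J) X a≢b) (Glue-at-sep (ψᴹ J) X)) (ℚ.+-identityʳ 0ℚ))
dual-sep a K IH ((b ∷ c ∷ cs) ∷ J) = trans (⟦⟧-≗0 (ψᴴ K) no-separation) 
  (sym (δ-≢ {I = glue b ((c ∷ cs) ∷ J)} {sep a K} (sep≢glue nonempty ∘ sym)))
  where
  no-separation : ∀ X → ψᴹ (glue b ((c ∷ cs) ∷ J)) at sep a X ≡ 0ℚ
  no-separation X = trans (ψᴹ-glue-at b {(c ∷ cs) ∷ J} nonempty (sep a X))
    (cong -_ (Glue-at-sep (ψᴹ ((c ∷ cs) ∷ J)) X))

∂-nonempty : (a : Fin k) (h : Sentence k → ℚ) {X : Sentence k} → NonEmpty X →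
  ∂ a h X ≡ h (sep a X) - h (glue a X)
∂-nonempty a h {X@(_ ∷ _)} nonempty = cong₂ _-_ (⟦⟧-basis (sep a X) h) (⟦⟧-basis (glue a X) h)

dual-glue : (a : Fin k) (K : Sentence k) → NonEmpty K → Dual K → (J : Sentence k) →
  ⟦ ψᴴ K ⟧ (∂ a (ψᴹ J at_)) ≡ δ J (glue a K)
dual-glue a K K≢[] IH [] = trans (⟦⟧-≗0 (ψᴴ K) pointwise) (sym (δ-≢ {I = []} {glue a K} ([]≢glue {a = a} {K})))
  where
  pointwise : ∀ X → ∂ a (ψᴹ [] at_) X ≡ 0ℚ
  pointwise [] = ℚ.+-inverseʳ 0ℚ
  pointwise X@(_ ∷ _) = trans (∂-nonempty a (ψᴹ [] at_) {X} nonempty)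
    (trans (cong₂ _-_ (trans (basis-at [] (sep a X)) (δ-≢ {I = []} {sep a X} λ ()))
                      (trans (basis-at [] (glue a X)) (δ-≢ {I = []} {glue a X} ([]≢glue {a = a} {X}))))
           (ℚ.+-inverseʳ 0ℚ))
dual-glue a K K≢[] IH ((b ∷ []) ∷ J) =
  trans (⟦⟧-≗0 (ψᴴ K) pointwise) (sym (δ-≢ {I = sep b J} {glue a K} (sep≢glue K≢[])))
  where
  Q = ψᴹ J
  by-letter : {X : Sentence _} → NonEmpty X → Dec (a ≡ b) →
    (Sep b Q at sep a X + Glue b Q at sep a X) - (Sep b Q at glue a X + Glue b Q at glue a X) ≡ 0ℚ
  by-letter {X} X≢[] (yes refl) = trans
    (cong₂ _-_ (cong₂ _+_ (Sep-at-sep a Q X) (Glue-at-sep Q X))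
               (cong₂ _+_ (Sep-at-glue Q X≢[]) (Glue-at-glue a Q X≢[])))
    (solve 1 (λ x → (x :+ con 0ℚ) :- (con 0ℚ :+ x) := con 0ℚ) refl (Q at X))
  by-letter {X} X≢[] (no a≢b) = trans
    (cong₂ _-_ (cong₂ _+_ (Sep-at-sep-≢ Q X a≢b) (Glue-at-sep Q X))
               (cong₂ _+_ (Sep-at-glue Q X≢[]) (Glue-at-glue-≢ Q X a≢b)))
    (ℚ.+-inverseʳ (0ℚ + 0ℚ))
  pointwise : ∀ X → ∂ a (ψᴹ (sep b J) at_) X ≡ 0ℚ
  pointwise [] = ℚ.+-inverseʳ 0ℚ
  pointwise X@(_ ∷ _) = trans (∂-nonempty a (ψᴹ (sep b J) at_) nonempty)
    (trans (cong₂ _-_ (ψᴹ-sep-at b J (sep a X)) (ψᴹ-sep-at b J (glue a X))) (by-letter nonempty (a Fin.≟ b)))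
dual-glue a K K≢[] IH ((b ∷ c ∷ cs) ∷ J) with a Fin.≟ b
... | yes refl = trans (⟦⟧-cong (ψᴴ K) pointwise)
  (trans (IH ((c ∷ cs) ∷ J)) (sym (δ-injective (glue a) glue-injective ((c ∷ cs) ∷ J) K)))
  where
  Q = ψᴹ ((c ∷ cs) ∷ J)
  pointwise : ∀ X → ∂ a (ψᴹ (glue a ((c ∷ cs) ∷ J)) at_) X ≡ Q at X
  pointwise [] = trans (ℚ.+-inverseʳ 0ℚ)
    (sym (trans (ψᴹ-at-[] ((c ∷ cs) ∷ J)) (δ-≢ {I = (c ∷ cs) ∷ J} {[]} λ ())))
  pointwise X@(_ ∷ _) = trans (∂-nonempty a (ψᴹ (glue a ((c ∷ cs) ∷ J)) at_) {X} nonempty)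
    (trans (cong₂ _-_ (trans (ψᴹ-glue-at a {(c ∷ cs) ∷ J} nonempty (sep a X)) (cong -_ (Glue-at-sep Q X)))
                      (trans (ψᴹ-glue-at a {(c ∷ cs) ∷ J} nonempty (glue a X)) (cong -_ (Glue-at-glue a Q nonempty))))
           (solve 1 (λ x → :- con 0ℚ :- :- x := x) refl (Q at X)))
... | no a≢b = trans (⟦⟧-≗0 (ψᴴ K) pointwise)
  (sym (δ-≢ {I = glue b ((c ∷ cs) ∷ J)} {glue a K} (a≢b ∘ sym ∘ glue-letter {Z = (c ∷ cs) ∷ J} {K})))
  where
  Q = ψᴹ ((c ∷ cs) ∷ J)
  pointwise : ∀ X → ∂ a (ψᴹ (glue b ((c ∷ cs) ∷ J)) at_) X ≡ 0ℚ
  pointwise [] = ℚ.+-inverseʳ 0ℚ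
  pointwise X@(_ ∷ _) = trans (∂-nonempty a (ψᴹ (glue b ((c ∷ cs) ∷ J)) at_) {X} nonempty)
    (trans (cong₂ _-_ (trans (ψᴹ-glue-at b {(c ∷ cs) ∷ J} nonempty (sep a X)) (cong -_ (Glue-at-sep Q X)))
                      (trans (ψᴹ-glue-at b {(c ∷ cs) ∷ J} nonempty (glue a X)) (cong -_ (Glue-at-glue-≢ Q X a≢b))))
           (ℚ.+-inverseʳ (- 0ℚ)))

ψᴴ-ψᴹ-dual : (I : Sentence k) → Dual I
ψᴴ-ψᴹ-dual = sentence-ind Dual
  (λ J → trans (⟦⟧-basis [] (ψᴹ J at_)) (ψᴹ-at-[] J))
  (λ a K IH J → trans (⟦Sep⟧ a (ψᴴ K) (ψᴹ J at_)) (dual-sep a K IH J))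
  (λ a K K≢[] IH J → trans (ψᴴ-glue′ a K K≢[] (ψᴹ J at_)) (dual-glue a K K≢[] IH J))

ψᴴ-nonempty-cong : (K : Sentence k) → NonEmpty K → {f f′ : Sentence k → ℚ} →
  (∀ X → NonEmpty X → f X ≡ f′ X) → ⟦ ψᴴ K ⟧ f ≡ ⟦ ψᴴ K ⟧ f′
ψᴴ-nonempty-cong = sentence-ind
  (λ K → NonEmpty K → {f f′ : Sentence _ → ℚ} →
         (∀ X → NonEmpty X → f X ≡ f′ X) → ⟦ ψᴴ K ⟧ f ≡ ⟦ ψᴴ K ⟧ f′)
  (λ ())
  (λ a K _ _ {f} {f′} f≐f′ → trans (⟦Sep⟧ a (ψᴴ K) f)
     (trans (⟦⟧-cong (ψᴴ K) (λ X → f≐f′ (sep a X) nonempty)) (sym (⟦Sep⟧ a (ψᴴ K) f′))))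
  (λ a K K≢[] IH _ {f} {f′} f≐f′ → trans (ψᴴ-glue a K K≢[] f)
     (trans (cong₂ _-_ (IH K≢[] (λ { X@(_ ∷ _) nonempty → cong (λ z → 1ℚ * z + 0ℚ) (f≐f′ (sep a X) nonempty) }))
                       (IH K≢[] (λ { X@(_ ∷ _) nonempty → cong (λ z → 1ℚ * z + 0ℚ) (f≐f′ (glue a X) nonempty) })))
            (sym (ψᴴ-glue a K K≢[] f′))))

ψᴴ-++ : (I J : Sentence k) (g : Sentence k → ℚ) →
  ⟦ ψᴴ (I ++ J) ⟧ g ≡ ⟦ ψᴴ I ⟧ (λ X → ⟦ ψᴴ J ⟧ (λ Y → g (X ++ Y)))
ψᴴ-++ I J = sentence-ind (λ I → ∀ g → ⟦ ψᴴ (I ++ J) ⟧ g ≡ ⟦ ψᴴ I ⟧ (λ X → ⟦ ψᴴ J ⟧ (λ Y → g (X ++ Y))))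
  (λ g → sym (⟦⟧-basis [] (λ X → ⟦ ψᴴ J ⟧ (λ Y → g (X ++ Y)))))
  (λ a K IH g → trans (⟦Sep⟧ a (ψᴴ (K ++ J)) g) (trans (IH (g ∘ sep a)) (sym (⟦Sep⟧ a (ψᴴ K) _))))
  case-glue I
  where
  case-glue : ∀ a K → NonEmpty K → (∀ g → ⟦ ψᴴ (K ++ J) ⟧ g ≡ ⟦ ψᴴ K ⟧ (λ X → ⟦ ψᴴ J ⟧ (λ Y → g (X ++ Y)))) →
    ∀ g → ⟦ ψᴴ (glue a K ++ J) ⟧ g ≡ ⟦ ψᴴ (glue a K) ⟧ (λ X → ⟦ ψᴴ J ⟧ (λ Y → g (X ++ Y)))
  case-glue a K@(_ ∷ _) nonempty IH g = begin
    ⟦ ψᴴ (glue a (K ++ J)) ⟧ g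
      ≡⟨ ψᴴ-glue a (K ++ J) nonempty g ⟩
    ⟦ ψᴴ (K ++ J) ⟧ (sep⁺ a ⋆ g) - ⟦ ψᴴ (K ++ J) ⟧ (glue⁺ a ⋆ g)
      ≡⟨ cong₂ _-_ (trans (IH (sep⁺ a ⋆ g)) (ψᴴ-nonempty-cong K nonempty (λ { (w ∷ X) nonempty → sep-first w X })))
                   (trans (IH (glue⁺ a ⋆ g)) (ψᴴ-nonempty-cong K nonempty (λ { (w ∷ X) nonempty → glue-first w X }))) ⟩
    ⟦ ψᴴ K ⟧ (sep⁺ a ⋆ G) - ⟦ ψᴴ K ⟧ (glue⁺ a ⋆ G)
      ≡⟨ sym (ψᴴ-glue a K nonempty G) ⟩
    ⟦ ψᴴ (glue a K) ⟧ G ∎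
    where
    open ≡-Reasoning
    G : Sentence _ → ℚ
    G X = ⟦ ψᴴ J ⟧ (λ Y → g (X ++ Y))
    sep-first : ∀ w X → ⟦ ψᴴ J ⟧ (λ Y → (sep⁺ a ⋆ g) ((w ∷ X) ++ Y)) ≡ (sep⁺ a ⋆ G) (w ∷ X)
    sep-first w X = trans (⟦⟧-cong (ψᴴ J) (λ Y → ⟦⟧-basis (sep a ((w ∷ X) ++ Y)) g))
      (sym (⟦⟧-basis (sep a (w ∷ X)) G))
    glue-first : ∀ w X → ⟦ ψᴴ J ⟧ (λ Y → (glue⁺ a ⋆ g) ((w ∷ X) ++ Y)) ≡ (glue⁺ a ⋆ G) (w ∷ X)
    glue-first w X = trans (⟦⟧-cong (ψᴴ J) (λ Y → ⟦⟧-basis (glue a ((w ∷ X) ++ Y)) g))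
      (sym (⟦⟧-basis (glue a (w ∷ X)) G))

SendsToComplement : (B φ : Sentence k → Vec k) → Set
SendsToComplement B φ = ∀ J g → ⟦ B J ⟧ (φ ⋆ g) ≡ ⟦ B (J ᶜ) ⟧ g

sendsToComplement⁺ : (B φ : Sentence k → Vec k) →
  (∀ J → ext φ (B J) ≈ B (J ᶜ)) → SendsToComplement B φ
sendsToComplement⁺ B φ φBJ≈BJᶜ J g =
  trans (sym (⟦⟧-ext φ (B J) g)) (≈⇒⟦⟧≡ (ext φ (B J)) (B (J ᶜ)) (φBJ≈BJᶜ J) g)

sendsToComplement⁻ : (B φ : Sentence k → Vec k) →
  SendsToComplement B φ → ∀ J → ext φ (B J) ≈ B (J ᶜ)
sendsToComplement⁻ B φ φ-B J = ⟦⟧≡⇒≈ (ext φ (B J)) (B (J ᶜ)) (λ g → trans (⟦⟧-ext φ (B J) g) (φ-B J g))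

module _ {k : ℕ} (B B⁻¹ : Sentence k → Vec k) (B⁻¹-expands : ∀ I g → ⟦ B⁻¹ I ⟧ (B ⋆ g) ≡ g I) where

  ⋆-determined : (φ : Sentence k → Vec k) → SendsToComplement B φ →
    ∀ g → φ ⋆ g ≗ (λ I → ⟦ B⁻¹ I ⟧ (λ L → ⟦ B (L ᶜ) ⟧ g))
  ⋆-determined φ φ-B g I = trans (sym (B⁻¹-expands I (φ ⋆ g))) (⟦⟧-cong (B⁻¹ I) (λ L → φ-B L g))

  ⋆-unique : (φ φ′ : Sentence k → Vec k) → SendsToComplement B φ → SendsToComplement B φ′ →
    ∀ g → φ ⋆ g ≗ φ′ ⋆ g
  ⋆-unique φ φ′ φ-B φ′-B g I = trans (⋆-determined φ φ-B g I) (sym (⋆-determined φ′ φ′-B g I))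

  ⋆-involutive : (φ : Sentence k → Vec k) → SendsToComplement B φ → ∀ g → φ ⋆ φ ⋆ g ≗ g
  ⋆-involutive φ φ-B g I = begin
    (φ ⋆ φ ⋆ g) I                              ≡⟨ ⋆-determined φ φ-B (φ ⋆ g) I ⟩
    ⟦ B⁻¹ I ⟧ (λ L → ⟦ B (L ᶜ) ⟧ (φ ⋆ g))      ≡⟨ ⟦⟧-cong (B⁻¹ I) (λ L → φ-B (L ᶜ) g) ⟩
    ⟦ B⁻¹ I ⟧ (λ L → ⟦ B (L ᶜ ᶜ) ⟧ g)          ≡⟨ ⟦⟧-cong (B⁻¹ I) (λ L → cong (λ L′ → ⟦ B L′ ⟧ g) (ᶜ-involutive L)) ⟩
    ⟦ B⁻¹ I ⟧ (B ⋆ g)                          ≡⟨ B⁻¹-expands I g ⟩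
    g I ∎
    where open ≡-Reasoning

ext-involutive : (φ : Sentence k → Vec k) → (∀ g → φ ⋆ φ ⋆ g ≗ g) → ∀ F → ext φ (ext φ F) ≈ F
ext-involutive φ φφ≗id F = ⟦⟧≡⇒≈ (ext φ (ext φ F)) F λ g →
  trans (⟦⟧-ext φ (ext φ F) g) (trans (⟦⟧-ext φ F (φ ⋆ g)) (⟦⟧-cong F (φφ≗id g)))

⟪⟫-⟦⟧ : (G F : Vec k) → ⟪ G , F ⟫ ≡ ⟦ G ⟧ (coeff F)
⟪⟫-⟦⟧ [] F = refl
⟪⟫-⟦⟧ ((c , I) ∷ G) F = cong (c * coeff F I +_) (⟪⟫-⟦⟧ G F)

module _ {k : ℕ} (ψN : Sentence k → Vec k) (ψN≐ψᴴ : ∀ g → ψN ⋆ g ≗ ψᴴ ⋆ g) where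

  ext-pairing-invariant : (ψQ : Sentence k → Vec k) → (∀ g → ψQ ⋆ g ≗ ψᴹ ⋆ g) →
    ∀ G F → ⟪ G , F ⟫ ≡ ⟪ ext ψN G , ext ψQ F ⟫
  ext-pairing-invariant ψQ ψQ≐ψᴹ G F = begin
    ⟪ G , F ⟫
      ≡⟨ ⟪⟫-⟦⟧ G F ⟩
    ⟦ G ⟧ (coeff F)
      ≡⟨ ⟦⟧-cong G (λ I → trans (coeff-⟦⟧ F I) (⟦⟧-cong F (λ J → sym (dual I J)))) ⟩
    ⟦ G ⟧ (λ I → ⟦ F ⟧ (λ J → ⟦ ψN I ⟧ (ψQ J at_)))
      ≡⟨ ⟦⟧-cong G (λ I → sym (⟦⟧-swap (ψN I) F (λ X J → ψQ J at X))) ⟩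
    ⟦ G ⟧ (λ I → ⟦ ψN I ⟧ (λ X → ⟦ F ⟧ (λ J → ψQ J at X)))
      ≡⟨ ⟦⟧-cong G (λ I → ⟦⟧-cong (ψN I) (λ X →
           trans (sym (⟦⟧-ext ψQ F (λ Y → δ Y X))) (sym (coeff-⟦⟧ (ext ψQ F) X)))) ⟩
    ⟦ G ⟧ (ψN ⋆ coeff (ext ψQ F))
      ≡⟨ sym (trans (⟪⟫-⟦⟧ (ext ψN G) (ext ψQ F)) (⟦⟧-ext ψN G _)) ⟩
    ⟪ ext ψN G , ext ψQ F ⟫ ∎
    where
    open ≡-Reasoning
    dual : ∀ I J → ⟦ ψN I ⟧ (ψQ J at_) ≡ δ J I
    dual I J = trans (ψN≐ψᴴ (ψQ J at_) I)
      (trans (⟦⟧-cong (ψᴴ I) (λ X → ψQ≐ψᴹ (λ Y → δ Y X) J)) (ψᴴ-ψᴹ-dual I J))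

  ext-multiplicative : ∀ G G′ → ext ψN (G · G′) ≈ ext ψN G · ext ψN G′
  ext-multiplicative G G′ = ⟦⟧≡⇒≈ (ext ψN (G · G′)) (ext ψN G · ext ψN G′) λ g → begin
    ⟦ ext ψN (G · G′) ⟧ g
      ≡⟨ trans (⟦⟧-ext ψN (G · G′) g) (⟦⟧-· G G′ _) ⟩
    ⟦ G ⟧ (λ I → ⟦ G′ ⟧ (λ J → (ψN ⋆ g) (I ++ J)))
      ≡⟨ ⟦⟧-cong G (λ I → ⟦⟧-cong G′ (λ J → ψN-++ I J g)) ⟩
    ⟦ G ⟧ (λ I → ⟦ G′ ⟧ (λ J → ⟦ ψN I ⟧ (λ X → ⟦ ψN J ⟧ (λ Y → g (X ++ Y)))))
      ≡⟨ ⟦⟧-cong G (λ I → sym (⟦⟧-swap (ψN I) G′ _)) ⟩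
    ⟦ G ⟧ (λ I → ⟦ ψN I ⟧ (λ X → ⟦ G′ ⟧ (λ J → ⟦ ψN J ⟧ (λ Y → g (X ++ Y)))))
      ≡⟨ ⟦⟧-cong G (λ I → ⟦⟧-cong (ψN I) (λ X → sym (⟦⟧-ext ψN G′ _))) ⟩
    ⟦ G ⟧ (ψN ⋆ (λ X → ⟦ ext ψN G′ ⟧ (λ Y → g (X ++ Y))))
      ≡⟨ sym (trans (⟦⟧-· (ext ψN G) (ext ψN G′) g) (⟦⟧-ext ψN G _)) ⟩
    ⟦ ext ψN G · ext ψN G′ ⟧ g ∎
    where
    open ≡-Reasoning
    ψN-++ : ∀ I J g → (ψN ⋆ g) (I ++ J) ≡ ⟦ ψN I ⟧ (λ X → ⟦ ψN J ⟧ (λ Y → g (X ++ Y)))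
    ψN-++ I J g = trans (ψN≐ψᴴ g (I ++ J)) (trans (ψᴴ-++ I J g)
      (sym (trans (ψN≐ψᴴ _ I) (⟦⟧-cong (ψᴴ I) (λ X → ψN≐ψᴴ _ J)))))

  ext-unit : ext ψN oneN ≈ oneN
  ext-unit = ⟦⟧≡⇒≈ (ext ψN oneN) oneN λ g →
    trans (⟦⟧-ext ψN oneN g) (trans (⟦⟧-basis [] (ψN ⋆ g)) (ψN≐ψᴴ g []))

proposition7p15 : (k : ℕ) →
    (Σ (Sentence k → Vec k) (λ ψ → ∀ J → ext ψ (Fb J) ≈ Fb (complement J))) ×
    (Σ (Sentence k → Vec k) (λ ψ → ∀ J → ext ψ (Rb J) ≈ Rb (complement J))) ×
    ((ψQ ψN : Sentence k → Vec k) →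
      (∀ J → ext ψQ (Fb J) ≈ Fb (complement J)) →
      (∀ J → ext ψN (Rb J) ≈ Rb (complement J)) →
      (∀ F → ext ψQ (ext ψQ F) ≈ F) ×
      (∀ G → ext ψN (ext ψN G) ≈ G) ×
      (∀ G F → ⟪ G , F ⟫ ≡ ⟪ ext ψN G , ext ψQ F ⟫) ×
      (∀ G G′ → ext ψN (G · G′) ≈ ext ψN G · ext ψN G′) ×
      (ext ψN oneN ≈ oneN))
proposition7p15 k =
  (ψᴹ , sendsToComplement⁻ Fb ψᴹ ψᴹ-Fb) ,
  (ψᴴ , sendsToComplement⁻ Rb ψᴴ ψᴴ-Rb) ,
  λ ψQ ψN ψQ-F ψN-R →
    let ψQ-Fᶜ = sendsToComplement⁺ Fb ψQ ψQ-F
        ψN-Rᶜ = sendsToComplement⁺ Rb ψN ψN-R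
        ψN≐ψᴴ = ⋆-unique Rb Hᴿ Rb-Hᴿ ψN ψᴴ ψN-Rᶜ ψᴴ-Rb
    in ext-involutive ψQ (⋆-involutive Fb Mᶠ Fb-Mᶠ ψQ ψQ-Fᶜ) ,
       ext-involutive ψN (⋆-involutive Rb Hᴿ Rb-Hᴿ ψN ψN-Rᶜ) ,
       ext-pairing-invariant ψN ψN≐ψᴴ ψQ (⋆-unique Fb Mᶠ Fb-Mᶠ ψQ ψᴹ ψQ-Fᶜ ψᴹ-Fb) ,
       ext-multiplicative ψN ψN≐ψᴴ ,
       ext-unit ψN ψN≐ψᴴ
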